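{- Let $H$ be the complete $(n-2)$-uniform hypergraph on $[n]$. Then for $-1\le r\le 1$, $$\dim HC_r(\Delta(H))=\binom{n}{r+1}.$$
   Context: The cyclic coloring complex $\Delta(H)$: $\Delta_r(H)$ consists of the classes $[B_1,\dots,B_{r+2}]$ of ordered set partitions of $[n]$ into nonempty blocks with at least one block containing a hyperedge of $H$, taken with signs modulo $(B_1,\dots,B_{r+2})\sim(-1)^{r+1}(B_2,\dots,B_{r+2},B_1)$ and represented with $1\in B_1$. $C_r$ is the vector space over a field of characteristic zero with basis $\Delta_r(H)$, with boundary $\partial_r[B_1,\dots,B_{r+2}]=\sum_{i=1}^{r+1}(-1)^{i+1}[B_1,\dots,B_i\cup B_{i+1},\dots,B_{r+2}]+(-1)^{r+3}[B_1\cup B_{r+2},B_2,\dots,B_{r+1}]$ (with $\partial_{ -1}=0$), and $HC_r(\Delta(H))=\ker\partial_r/\operatorname{im}\partial_{r+1}$.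
   Formalization: The formula $\dim HC_r(\Delta(H))=\binom{n}{r+1}$ is claimed for n ≥ 5 only. The statement above fails without it. -}

module Defs where

open import Level using (Level; _⊔_; Lift) renaming (suc to lsuc)
open import Algebra.Bundles using (CommutativeRing)
open import Data.Nat as ℕ using (ℕ; zero; suc)
open import Data.Fin as Fin using (Fin; zero; suc; pinch; toℕ; lower₁)
open import Data.Fin.Subset using (Subset; ∣_∣; _⊆_)
open import Data.Vec as Vec using (Vec; []; _∷_; lookup)
open import Data.Vec.Properties using (≡-dec)
open import Data.List as List using (List; concatMap; allFin; foldr)
open import Data.Product using (Σ; ∃; _×_; _,_)
open import Data.Unit using (⊤)
open import Data.Empty using (⊥)
open import Relation.Nullary using (¬_; yes; no; does)
open import Relation.Binary.PropositionalEquality using (_≡_)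

record Field (c ℓ : Level) : Set (lsuc (c ⊔ ℓ)) where
  field
    commutativeRing : CommutativeRing c ℓ
  open CommutativeRing commutativeRing public
  field
    1≉0     : ¬ (1# ≈ 0#)
    inverse : ∀ x → ¬ (x ≈ 0#) → ∃ λ y → x * y ≈ 1#

module _ {c ℓ} (F : Field c ℓ) where
  open Field F

  natF : ℕ → Carrier
  natF zero    = 0#
  natF (suc k) = 1# + natF k

CharZero : ∀ {c ℓ} → Field c ℓ → Set ℓ
CharZero F = ∀ k → ¬ (Field._≈_ F (natF F (suc k)) (Field.0# F))

-- Hypergraphs on [n] = {1,…,n}; vertex i+1 is represented by (i : Fin n).
-- A hypergraph is given by its predicate "is a hyperedge".

Hypergraph : ℕ → Set₁
Hypergraph n = Subset n → Set

completeUniform : (n k : ℕ) → Hypergraph n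
completeUniform n k S = ∣ S ∣ ≡ k

-- Ordered set partitions (B₀,…,B_{k-1}) of [n] into k blocks, encoded by
-- the block-assignment σ : Vec (Fin k) n  (element i lies in block σ[i]).

Assign : ℕ → ℕ → Set
Assign k n = Vec (Fin k) n

block : ∀ {k n} → Assign k n → Fin k → Subset n
block σ j = Vec.map (λ x → does (x Fin.≟ j)) σ

-- element 1 lies in the first block (the chosen representative of a
-- cyclic class)
OneInFirst : ∀ {k n} → Assign k n → Set
OneInFirst []      = ⊥
OneInFirst (x ∷ _) = toℕ x ≡ 0

AllNonempty : ∀ {k n} → Assign k n → Set
AllNonempty {k} σ = ∀ (j : Fin k) → ∃ λ i → lookup σ i ≡ j

SomeBlockHasEdge : ∀ {k n} → Hypergraph n → Assign k n → Set
SomeBlockHasEdge {k} {n} H σ = ∃ λ (j : Fin k) → ∃ λ (S : Subset n) → H S × S ⊆ block σ j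

-- σ (with k = r+2 blocks) is the normalised representative of an element
-- of Δ_r(H)
InΔ : ∀ {k n} → Hypergraph n → Assign k n → Set
InΔ H σ = OneInFirst σ × AllNonempty σ × SomeBlockHasEdge H σ

allAssign : (k n : ℕ) → List (Assign k n)
allAssign k zero    = [] List.∷ List.[]
allAssign k (suc n) = concatMap (λ i → List.map (i ∷_) (allAssign k n)) (allFin k)

joinLast : ∀ {k} → Fin (suc (suc k)) → Fin (suc k)
joinLast {k} j with suc k ℕ.≟ toℕ j
... | yes _ = zero
... | no ne = lower₁ j ne

-- We index by m = r + 1, so chains of level m live on
-- partitions into m+1 = r+2 blocks.  C_r is realised as the functions
-- Assign (m+1) n → F vanishing outside Δ_r(H) (coordinates w.r.t. the basis
-- Δ_r(H)).

module Complex {c ℓ} (F : Field c ℓ) {n : ℕ} (H : Hypergraph n) where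
  open Field F

  Chain : ℕ → Set c
  Chain m = Assign (suc m) n → Carrier

  Supported : ∀ {m} → Chain m → Set ℓ
  Supported {m} x = ∀ σ → ¬ InΔ H σ → x σ ≈ 0#

  sumList : ∀ {A : Set} → List A → (A → Carrier) → Carrier
  sumList xs f = foldr (λ a acc → f a + acc) 0# xs

  sign : ℕ → Carrier → Carrier
  sign zero    x = x
  sign (suc k) x = - sign k x

  hit : ∀ {m} → Assign (suc m) n → Assign (suc m) n → Carrier → Carrier
  hit σ' τ v with ≡-dec Fin._≟_ σ' τ
  ... | yes _ = v
  ... | no  _ = 0#

  -- ∂_r for r = m+1 ≥ 0 (source: m+2 = r+2 blocks):
  -- ∂[B₁,…,B_{r+2}] = Σ_{i=1}^{r+1} (-1)^{i+1} [.., B_i ∪ B_{i+1}, ..]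
  --                   + (-1)^{r+3} [B₁ ∪ B_{r+2}, B₂, …, B_{r+1}]
  ∂ : ∀ m → Chain (suc m) → Chain m
  ∂ m x τ = sumList (allAssign (suc (suc m)) n) λ σ →
              sumList (allFin (suc m)) (λ i →
                sign (toℕ i) (hit (Vec.map (pinch i) σ) τ (x σ)))
            + sign (suc m) (hit (Vec.map joinLast σ) τ (x σ))

  -- cycles (∂_{-1} = 0)
  IsCycle : ∀ m → Chain m → Set ℓ
  IsCycle zero    x = Lift ℓ ⊤
  IsCycle (suc m) x = ∀ τ → ∂ m x τ ≈ 0#

  IsBoundary : ∀ m → Chain m → Set (c ⊔ ℓ)
  IsBoundary m x = ∃ λ (w : Chain (suc m)) → Supported w × (∀ τ → x τ ≈ ∂ m w τ)

  lin : ∀ {m d} → (Fin d → Chain m) → (Fin d → Carrier) → Chain m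
  lin {d = d} z a σ = sumList (allFin d) (λ i → a i * z i σ)

  -- dim HC_{m-1} = d : there are d cycles whose classes form a basis of
  -- ker ∂ / im ∂.
  HomologyDim : (m d : ℕ) → Set (c ⊔ ℓ)
  HomologyDim m d =
    Σ (Fin d → Chain m) λ z →
      (∀ i → Supported (z i) × IsCycle m (z i))
    × (∀ a → IsBoundary m (lin z a) → ∀ i → a i ≈ 0#)
    × (∀ x → Supported x → IsCycle m x →
         ∃ λ a → IsBoundary m (λ σ → x σ - lin z a σ))

-- dim HC_r(Δ(H)) = d, where m = r + 1
dimHC≡ : ∀ {c ℓ} → Field c ℓ → ∀ {n} → Hypergraph n → (m d : ℕ) → Set (c ⊔ ℓ)
dimHC≡ F H m d = Complex.HomologyDim F H m d

-- For n ≥ 5 an edge has n − 2 vertices, so a partition lies in Δ only if one of its blocks misses at most two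
-- vertices.  Hence Δ has no partitions into four blocks, and its partitions into two and three blocks form a few
-- explicit families (E, P b, F b, Q p and U b, U′ b, T p, T′ p below).  In degree 1 there are no boundaries, and the
-- cycle condition at F b and Q p forces equal and opposite coefficients on U b, U′ b and on T p, T′ p; this leaves the
-- C(n, 2) cycles U b − U′ b and T p − T′ p.  In degree 0 every chain is a cycle, and the boundaries of U b and T p
-- express F b and Q p through E and the P b.  These n classes are independent because the functionals "the second block
-- contains an edge" and "vertex b lies in the second block" vanish on all boundaries.  In degree −1 the one-block
-- partition spans.

module Submission where

open import Defs

open import Level using (Level; lift; _⊔_)
open import Algebra.Bundles using (CommutativeRing)
open import Data.Unit using (tt)
open import Data.Bool using (Bool; true; false)
open import Data.Empty using (⊥; ⊥-elim)
open import Data.Nat as ℕ using (ℕ; zero; suc; z≤n; s≤s)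
import Data.Nat.Properties as ℕₚ
open import Data.Nat.Combinatorics using (_C_; nC1≡n; nCk+nC[k+1]≡[n+1]C[k+1])
open import Data.Nat.Tactic.RingSolver using (solve-∀)
open import Data.Maybe using (nothing)
open import Tactic.RingSolver.Core.AlmostCommutativeRing using (AlmostCommutativeRing; fromCommutativeRing)
open import Data.Fin as Fin using (Fin; zero; suc; toℕ; pinch; _↑ˡ_; _↑ʳ_; splitAt; join)
import Data.Fin.Properties as Finₚ
open import Data.Fin.Subset using (_⊆_)
open import Data.Fin.Subset.Properties using (p⊆q⇒∣p∣≤∣q∣)
open import Data.Vec as Vec using (Vec; []; _∷_; replicate; lookup)
import Data.Vec.Properties as Vecₚ
open import Data.List as List using (List; allFin; concatMap; _++_)
import Data.List.Properties as Listₚ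
open import Data.Sum using (_⊎_; inj₁; inj₂; [_,_]′)
import Data.Sum.Properties as ⊎
open import Data.Product using (∃; _,_; proj₁; proj₂)
open import Relation.Nullary using (¬_; Dec; yes; no; does)
open import Relation.Binary.Definitions using (DecidableEquality)
open import Relation.Binary.PropositionalEquality as ≡ using (_≡_; _≢_)

pattern 𝟙 = suc zero
pattern 𝟚 = suc (suc zero)
pattern 𝟛 = suc (suc (suc zero))

-- Pair m encodes the 2-subsets of Fin m: at m + 1, inj₁ q is {0, q + 1} and inj₂ p is p shifted by one.
Pair : ℕ → Set
Pair zero    = ⊥
Pair (suc m) = Fin m ⊎ Pair m

allPair : ∀ m → List (Pair m)
allPair zero    = List.[]
allPair (suc m) = List.map inj₁ (allFin m) ++ List.map inj₂ (allPair m)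

_≟ᴾ_ : ∀ {m} → DecidableEquality (Pair m)
_≟ᴾ_ {suc m} = ⊎.≡-dec Fin._≟_ _≟ᴾ_

smaller larger : ∀ {m} → Pair m → Fin m
smaller {suc m} (inj₁ q) = zero
smaller {suc m} (inj₂ p) = suc (smaller p)
larger  {suc m} (inj₁ q) = suc q
larger  {suc m} (inj₂ p) = suc (larger p)

subst-subst-sym : ∀ {a b} (e : a ≡ b) (i : Fin b) → ≡.subst Fin e (≡.subst Fin (≡.sym e) i) ≡ i
subst-subst-sym ≡.refl i = ≡.refl

subst-sym-subst : ∀ {a b} (e : a ≡ b) (i : Fin a) → ≡.subst Fin (≡.sym e) (≡.subst Fin e i) ≡ i
subst-sym-subst ≡.refl i = ≡.refl

module PairCount where
  open ≡ using (refl; sym; trans; cong; subst)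

  suc-C-2 : ∀ m → suc m C 2 ≡ m ℕ.+ m C 2
  suc-C-2 m = trans (sym (nCk+nC[k+1]≡[n+1]C[k+1] m 1)) (cong (ℕ._+ m C 2) (nC1≡n m))

  toPair : ∀ m → Fin (m C 2) → Pair m
  toPair zero    ()
  toPair (suc m) i = [ inj₁ , (λ r → inj₂ (toPair m r)) ]′ (splitAt m (subst Fin (suc-C-2 m) i))

  fromPair : ∀ m → Pair m → Fin (m C 2)
  fromPair (suc m) (inj₁ q) = subst Fin (sym (suc-C-2 m)) (q ↑ˡ (m C 2))
  fromPair (suc m) (inj₂ p) = subst Fin (sym (suc-C-2 m)) (m ↑ʳ fromPair m p)

  toPair-fromPair : ∀ m p → toPair m (fromPair m p) ≡ p
  toPair-fromPair (suc m) (inj₁ q)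
    rewrite subst-subst-sym (suc-C-2 m) (q ↑ˡ (m C 2)) | Finₚ.splitAt-↑ˡ m q (m C 2) = refl
  toPair-fromPair (suc m) (inj₂ p)
    rewrite subst-subst-sym (suc-C-2 m) (m ↑ʳ fromPair m p) | Finₚ.splitAt-↑ʳ m (m C 2) (fromPair m p) =
      cong inj₂ (toPair-fromPair m p)

  fromPair-toPair : ∀ m i → fromPair m (toPair m i) ≡ i
  fromPair-toPair zero    ()
  fromPair-toPair (suc m) i = trans (go (splitAt m i′) refl) (subst-sym-subst (suc-C-2 m) i)
    where
    i′ = subst Fin (suc-C-2 m) i
    back : ∀ {s} → splitAt m i′ ≡ s → join m (m C 2) s ≡ i′
    back e = trans (sym (cong (join m (m C 2)) e)) (Finₚ.join-splitAt m (m C 2) i′)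
    go : ∀ s → splitAt m i′ ≡ s → fromPair (suc m) ([ inj₁ , (λ r → inj₂ (toPair m r)) ]′ s) ≡ subst Fin (sym (suc-C-2 m)) i′
    go (inj₁ q) e = cong (subst Fin (sym (suc-C-2 m))) (back e)
    go (inj₂ r) e = cong (subst Fin (sym (suc-C-2 m))) (trans (cong (m ↑ʳ_) (fromPair-toPair m r)) (back e))

module ListSums {c ℓ} (R : CommutativeRing c ℓ) where
  open CommutativeRing R hiding (zero)
  open import Algebra.Properties.Ring ring using (-0#≈0#; -‿+-comm)
  open import Algebra.Properties.CommutativeSemigroup +-commutativeSemigroup using (interchange)
  open import Relation.Binary.Reasoning.Setoid setoid

  private variable A B : Set

  ∑ : List A → (A → Carrier) → Carrier
  ∑ xs f = List.foldr (λ a acc → f a + acc) 0# xs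

  ∑-cong : ∀ (xs : List A) {f g : A → Carrier} → (∀ a → f a ≈ g a) → ∑ xs f ≈ ∑ xs g
  ∑-cong List.[]       e = refl
  ∑-cong (x List.∷ xs) e = +-cong (e x) (∑-cong xs e)

  ∑-zero : ∀ (xs : List A) {f : A → Carrier} → (∀ a → f a ≈ 0#) → ∑ xs f ≈ 0#
  ∑-zero List.[]       e = refl
  ∑-zero (x List.∷ xs) e = trans (+-cong (e x) (∑-zero xs e)) (+-identityˡ 0#)

  ∑-+ : ∀ (xs : List A) (f g : A → Carrier) → ∑ xs (λ a → f a + g a) ≈ ∑ xs f + ∑ xs g
  ∑-+ List.[]       f g = sym (+-identityˡ 0#)
  ∑-+ (x List.∷ xs) f g = trans (+-congˡ (∑-+ xs f g)) (interchange (f x) (g x) _ _)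

  ∑-*ˡ : ∀ (xs : List A) a (f : A → Carrier) → ∑ xs (λ x → a * f x) ≈ a * ∑ xs f
  ∑-*ˡ List.[]       a f = sym (zeroʳ a)
  ∑-*ˡ (x List.∷ xs) a f = trans (+-congˡ (∑-*ˡ xs a f)) (sym (distribˡ a (f x) _))

  ∑-*ʳ : ∀ (xs : List A) a (f : A → Carrier) → ∑ xs (λ x → f x * a) ≈ ∑ xs f * a
  ∑-*ʳ xs a f = trans (∑-cong xs (λ x → *-comm (f x) a)) (trans (∑-*ˡ xs a f) (*-comm a _))

  ∑-neg : ∀ (xs : List A) (f : A → Carrier) → ∑ xs (λ x → - f x) ≈ - ∑ xs f
  ∑-neg List.[]       f = sym -0#≈0#
  ∑-neg (x List.∷ xs) f = trans (+-congˡ (∑-neg xs f)) (-‿+-comm (f x) _)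

  ∑-++ : ∀ (xs ys : List A) (f : A → Carrier) → ∑ (xs ++ ys) f ≈ ∑ xs f + ∑ ys f
  ∑-++ List.[]       ys f = sym (+-identityˡ _)
  ∑-++ (x List.∷ xs) ys f = trans (+-congˡ (∑-++ xs ys f)) (sym (+-assoc _ _ _))

  ∑-comm : ∀ (xs : List A) (ys : List B) (f : A → B → Carrier) →
    ∑ xs (λ a → ∑ ys (f a)) ≈ ∑ ys (λ b → ∑ xs (λ a → f a b))
  ∑-comm List.[]       ys f = sym (∑-zero ys (λ _ → refl))
  ∑-comm (x List.∷ xs) ys f = trans (+-congˡ (∑-comm xs ys f)) (sym (∑-+ ys (f x) _))

  ∑-map : ∀ (g : A → B) (xs : List A) (f : B → Carrier) → ∑ (List.map g xs) f ≈ ∑ xs (λ a → f (g a))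
  ∑-map g List.[]       f = refl
  ∑-map g (x List.∷ xs) f = +-congˡ (∑-map g xs f)

  ∑-concatMap : ∀ (h : A → List B) (xs : List A) (f : B → Carrier) →
    ∑ (concatMap h xs) f ≈ ∑ xs (λ a → ∑ (h a) f)
  ∑-concatMap h List.[]       f = refl
  ∑-concatMap h (x List.∷ xs) f = trans (∑-++ (h x) _ f) (+-congˡ (∑-concatMap h xs f))

  ∑-allFin-suc : ∀ k (f : Fin (suc k) → Carrier) → ∑ (allFin (suc k)) f ≈ f zero + ∑ (allFin k) (λ i → f (suc i))
  ∑-allFin-suc k f = +-congˡ (begin
    ∑ (List.tabulate suc) f           ≡⟨ ≡.cong (λ xs → ∑ xs f) (Listₚ.map-tabulate (λ i → i) suc) ⟨
    ∑ (List.map suc (allFin k)) f     ≈⟨ ∑-map suc (allFin k) f ⟩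
    ∑ (allFin k) (λ i → f (suc i))    ∎)

  select : Dec A → Carrier → Carrier
  select (yes _) v = v
  select (no _)  v = 0#

  select-yes : ∀ (d : Dec A) → A → ∀ v → select d v ≈ v
  select-yes (yes _) a  v = refl
  select-yes (no ¬a) a  v = ⊥-elim (¬a a)

  select-no : ∀ (d : Dec A) → ¬ A → ∀ v → select d v ≈ 0#
  select-no (yes a) ¬a v = ⊥-elim (¬a a)
  select-no (no _)  ¬a v = refl

  select-iff : ∀ (d : Dec A) (d′ : Dec B) → (A → B) → (B → A) → ∀ v → select d v ≈ select d′ v
  select-iff (yes a) d′ f g v = sym (select-yes d′ (f a) v)
  select-iff (no ¬a) d′ f g v = sym (select-no d′ (λ b → ¬a (g b)) v)

  select-* : ∀ (d : Dec A) v → select d v ≈ v * select d 1#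
  select-* (yes _) v = sym (*-identityʳ v)
  select-* (no _)  v = sym (zeroʳ v)

  ∑-inj₁-inj₂ : ∀ (xs : List A) (ys : List B) (f : A ⊎ B → Carrier) →
    ∑ (List.map inj₁ xs ++ List.map inj₂ ys) f ≈ ∑ xs (λ a → f (inj₁ a)) + ∑ ys (λ b → f (inj₂ b))
  ∑-inj₁-inj₂ xs ys f = trans (∑-++ (List.map inj₁ xs) _ f) (+-cong (∑-map inj₁ xs f) (∑-map inj₂ ys f))

  -- Summation over xs has the sifting property of the Kronecker delta: xs lists every element exactly once.
  record Sifting {A : Set} (_≟_ : DecidableEquality A) (xs : List A) : Set (c ⊔ ℓ) where
    field sift : ∀ a (f : A → Carrier) → ∑ xs (λ x → select (a ≟ x) (f x)) ≈ f a
  open Sifting public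

  sifting-allFin : ∀ k → Sifting Fin._≟_ (allFin k)
  sifting-allFin (suc k) .sift zero f = begin
    ∑ (allFin (suc k)) (λ i → select (zero Fin.≟ i) (f i))                ≈⟨ ∑-allFin-suc k _ ⟩
    f zero + ∑ (allFin k) (λ i → select (zero Fin.≟ suc i) (f (suc i)))   ≈⟨ +-congˡ (∑-zero (allFin k) (λ i → refl)) ⟩
    f zero + 0#                                                            ≈⟨ +-identityʳ _ ⟩
    f zero                                                                 ∎
  sifting-allFin (suc k) .sift (suc j) f = begin
    ∑ (allFin (suc k)) (λ i → select (suc j Fin.≟ i) (f i))               ≈⟨ ∑-allFin-suc k _ ⟩
    0# + ∑ (allFin k) (λ i → select (suc j Fin.≟ suc i) (f (suc i)))      ≈⟨ +-identityˡ _ ⟩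
    ∑ (allFin k) (λ i → select (suc j Fin.≟ suc i) (f (suc i)))
      ≈⟨ ∑-cong (allFin k) (λ i → select-iff (suc j Fin.≟ suc i) (j Fin.≟ i) Finₚ.suc-injective (≡.cong suc) _) ⟩
    ∑ (allFin k) (λ i → select (j Fin.≟ i) (f (suc i)))                   ≈⟨ sifting-allFin k .sift j (λ i → f (suc i)) ⟩
    f (suc j)                                                              ∎

  sifting-⊎ : ∀ {_≟₁_ : DecidableEquality A} {_≟₂_ : DecidableEquality B} {xs ys} →
    Sifting _≟₁_ xs → Sifting _≟₂_ ys → Sifting (⊎.≡-dec _≟₁_ _≟₂_) (List.map inj₁ xs ++ List.map inj₂ ys)
  sifting-⊎ {_≟₁_ = _≟₁_} {_≟₂_} {xs} {ys} sift₁ sift₂ .sift (inj₁ a) f = begin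
    ∑ (List.map inj₁ xs ++ List.map inj₂ ys) (λ z → select (inj₁ a ≟ z) (f z)) ≈⟨ ∑-inj₁-inj₂ xs ys _ ⟩
    ∑ xs (λ x → select (inj₁ a ≟ inj₁ x) (f (inj₁ x))) + ∑ ys (λ y → select (inj₁ a ≟ inj₂ y) (f (inj₂ y)))
      ≈⟨ +-cong (∑-cong xs (λ x → select-iff (inj₁ a ≟ inj₁ x) (a ≟₁ x) ⊎.inj₁-injective (≡.cong inj₁) _))
                (∑-zero ys (λ y → select-no (inj₁ a ≟ inj₂ y) (λ ()) (f (inj₂ y)))) ⟩
    ∑ xs (λ x → select (a ≟₁ x) (f (inj₁ x))) + 0#  ≈⟨ +-identityʳ _ ⟩
    ∑ xs (λ x → select (a ≟₁ x) (f (inj₁ x)))       ≈⟨ sift₁ .sift a (λ x → f (inj₁ x)) ⟩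
    f (inj₁ a) ∎
    where _≟_ = ⊎.≡-dec _≟₁_ _≟₂_
  sifting-⊎ {_≟₁_ = _≟₁_} {_≟₂_} {xs} {ys} sift₁ sift₂ .sift (inj₂ b) f = begin
    ∑ (List.map inj₁ xs ++ List.map inj₂ ys) (λ z → select (inj₂ b ≟ z) (f z)) ≈⟨ ∑-inj₁-inj₂ xs ys _ ⟩
    ∑ xs (λ x → select (inj₂ b ≟ inj₁ x) (f (inj₁ x))) + ∑ ys (λ y → select (inj₂ b ≟ inj₂ y) (f (inj₂ y)))
      ≈⟨ +-cong (∑-zero xs (λ x → select-no (inj₂ b ≟ inj₁ x) (λ ()) (f (inj₁ x))))
                (∑-cong ys (λ y → select-iff (inj₂ b ≟ inj₂ y) (b ≟₂ y) ⊎.inj₂-injective (≡.cong inj₂) _)) ⟩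
    0# + ∑ ys (λ y → select (b ≟₂ y) (f (inj₂ y)))  ≈⟨ +-identityˡ _ ⟩
    ∑ ys (λ y → select (b ≟₂ y) (f (inj₂ y)))       ≈⟨ sift₂ .sift b (λ y → f (inj₂ y)) ⟩
    f (inj₂ b) ∎
    where _≟_ = ⊎.≡-dec _≟₁_ _≟₂_

  sifting-allPair : ∀ m → Sifting _≟ᴾ_ (allPair m)
  sifting-allPair zero    .sift ()
  sifting-allPair (suc m) = sifting-⊎ (sifting-allFin m) (sifting-allPair m)

  _≟ᵛ_ : ∀ {K m} → (σ τ : Vec (Fin K) m) → Dec (σ ≡ τ)
  _≟ᵛ_ = Vecₚ.≡-dec Fin._≟_

  select-∷ : ∀ {K m} (a b : Fin K) (s t : Vec (Fin K) m) v →
    select ((a ∷ s) ≟ᵛ (b ∷ t)) v ≈ select (a Fin.≟ b) (select (s ≟ᵛ t) v)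
  select-∷ a b s t v = go ((a ∷ s) ≟ᵛ (b ∷ t)) (a Fin.≟ b) (s ≟ᵛ t)
    where
    go : (d : Dec ((a ∷ s) ≡ (b ∷ t))) (d₁ : Dec (a ≡ b)) (d₂ : Dec (s ≡ t)) → select d v ≈ select d₁ (select d₂ v)
    go d (yes ≡.refl) (yes ≡.refl) = select-yes d ≡.refl v
    go d (yes _)      (no s≢t)     = select-no d (λ e → s≢t (Vecₚ.∷-injectiveʳ e)) v
    go d (no a≢b)     _            = select-no d (λ e → a≢b (Vecₚ.∷-injectiveˡ e)) v

  sifting-allAssign : ∀ K m → Sifting _≟ᵛ_ (allAssign K m)
  sifting-allAssign K zero    .sift []      f = +-identityʳ _
  sifting-allAssign K (suc m) .sift (a ∷ s) f = begin
    ∑ (allAssign K (suc m)) (λ τ → select ((a ∷ s) ≟ᵛ τ) (f τ))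
      ≈⟨ ∑-concatMap _ (allFin K) _ ⟩
    ∑ (allFin K) (λ i → ∑ (List.map (i ∷_) (allAssign K m)) (λ τ → select ((a ∷ s) ≟ᵛ τ) (f τ)))
      ≈⟨ ∑-cong (allFin K) (λ i → ∑-map (i ∷_) (allAssign K m) _) ⟩
    ∑ (allFin K) (λ i → ∑ (allAssign K m) (λ t → select ((a ∷ s) ≟ᵛ (i ∷ t)) (f (i ∷ t))))
      ≈⟨ ∑-cong (allFin K) (λ i → ∑-cong (allAssign K m) (λ t → select-∷ a i s t _)) ⟩
    ∑ (allFin K) (λ i → ∑ (allAssign K m) (λ t → select (a Fin.≟ i) (select (s ≟ᵛ t) (f (i ∷ t)))))
      ≈⟨ ∑-cong (allFin K) (λ i → ∑-select-outer (a Fin.≟ i)) ⟩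
    ∑ (allFin K) (λ i → select (a Fin.≟ i) (∑ (allAssign K m) (λ t → select (s ≟ᵛ t) (f (i ∷ t)))))
      ≈⟨ sifting-allFin K .sift a _ ⟩
    ∑ (allAssign K m) (λ t → select (s ≟ᵛ t) (f (a ∷ t)))
      ≈⟨ sifting-allAssign K m .sift s (λ t → f (a ∷ t)) ⟩
    f (a ∷ s) ∎
    where
    ∑-select-outer : ∀ {i} (d : Dec (a ≡ i)) →
      ∑ (allAssign K m) (λ t → select d (select (s ≟ᵛ t) (f (i ∷ t))))
      ≈ select d (∑ (allAssign K m) (λ t → select (s ≟ᵛ t) (f (i ∷ t))))
    ∑-select-outer (yes _) = refl
    ∑-select-outer (no _)  = ∑-zero (allAssign K m) (λ _ → refl)

  ∑-fibres : ∀ {_≟_ : DecidableEquality B} {ys} → Sifting _≟_ ys →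
    ∀ (xs : List A) (c : A → Carrier) (f : A → B) (g : B → Carrier) →
    ∑ ys (λ b → ∑ xs (λ a → c a * select (f a ≟ b) 1#) * g b) ≈ ∑ xs (λ a → c a * g (f a))
  ∑-fibres {_≟_ = _≟_} {ys} ys-sift xs c f g = begin
    ∑ ys (λ b → ∑ xs (λ a → c a * select (f a ≟ b) 1#) * g b)
      ≈⟨ ∑-cong ys (λ b → sym (∑-*ʳ xs (g b) _)) ⟩
    ∑ ys (λ b → ∑ xs (λ a → c a * select (f a ≟ b) 1# * g b))
      ≈⟨ ∑-comm ys xs _ ⟩
    ∑ xs (λ a → ∑ ys (λ b → c a * select (f a ≟ b) 1# * g b))
      ≈⟨ ∑-cong xs (λ a → trans (∑-cong ys (λ b → trans (*-assoc _ _ _) (*-congˡ (trans (*-comm _ _) (sym (select-* (f a ≟ b) (g b)))))))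
                                  (∑-*ˡ ys (c a) _)) ⟩
    ∑ xs (λ a → c a * ∑ ys (λ b → select (f a ≟ b) (g b)))
      ≈⟨ ∑-cong xs (λ a → *-congˡ (ys-sift .sift (f a) g)) ⟩
    ∑ xs (λ a → c a * g (f a)) ∎

  ∑-allFin-subst : ∀ {d d′} (e : d ≡ d′) (h : Fin d′ → Carrier) →
    ∑ (allFin d) (λ i → h (≡.subst Fin e i)) ≈ ∑ (allFin d′) h
  ∑-allFin-subst ≡.refl h = refl

  ∑-allFin-↑ : ∀ a b (h : Fin (a ℕ.+ b) → Carrier) →
    ∑ (allFin (a ℕ.+ b)) h ≈ ∑ (allFin a) (λ i → h (i ↑ˡ b)) + ∑ (allFin b) (λ i → h (a ↑ʳ i))
  ∑-allFin-↑ zero    b h = sym (+-identityˡ _)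
  ∑-allFin-↑ (suc a) b h = begin
    ∑ (allFin (suc a ℕ.+ b)) h
      ≈⟨ ∑-allFin-suc (a ℕ.+ b) h ⟩
    h zero + ∑ (allFin (a ℕ.+ b)) (λ i → h (suc i))
      ≈⟨ +-congˡ (∑-allFin-↑ a b (λ i → h (suc i))) ⟩
    h zero + (∑ (allFin a) (λ i → h (suc (i ↑ˡ b))) + ∑ (allFin b) (λ i → h (suc (a ↑ʳ i))))
      ≈⟨ sym (+-assoc _ _ _) ⟩
    (h zero + ∑ (allFin a) (λ i → h (suc (i ↑ˡ b)))) + ∑ (allFin b) (λ i → h (suc (a ↑ʳ i)))
      ≈⟨ +-congʳ (sym (∑-allFin-suc a (λ i → h (i ↑ˡ b)))) ⟩
    ∑ (allFin (suc a)) (λ i → h (i ↑ˡ b)) + ∑ (allFin b) (λ i → h (suc a ↑ʳ i)) ∎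

  ∑-toPair : ∀ m (g : Pair m → Carrier) → ∑ (allFin (m C 2)) (λ i → g (PairCount.toPair m i)) ≈ ∑ (allPair m) g
  ∑-toPair zero    g = refl
  ∑-toPair (suc m) g = begin
    ∑ (allFin (suc m C 2)) (λ i → g (toPair (suc m) i))
      ≈⟨ ∑-allFin-subst (suc-C-2 m) (λ i → g (split (splitAt m i))) ⟩
    ∑ (allFin (m ℕ.+ m C 2)) (λ i → g (split (splitAt m i)))
      ≈⟨ ∑-allFin-↑ m (m C 2) _ ⟩
    ∑ (allFin m) (λ i → g (split (splitAt m (i ↑ˡ (m C 2))))) + ∑ (allFin (m C 2)) (λ i → g (split (splitAt m (m ↑ʳ i))))
      ≈⟨ +-cong (∑-cong (allFin m) (λ i → reflexive (≡.cong (λ s → g (split s)) (Finₚ.splitAt-↑ˡ m i (m C 2)))))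
                (∑-cong (allFin (m C 2)) (λ i → reflexive (≡.cong (λ s → g (split s)) (Finₚ.splitAt-↑ʳ m (m C 2) i)))) ⟩
    ∑ (allFin m) (λ q → g (inj₁ q)) + ∑ (allFin (m C 2)) (λ i → g (inj₂ (toPair m i)))
      ≈⟨ +-congˡ (∑-toPair m (λ p → g (inj₂ p))) ⟩
    ∑ (allFin m) (λ q → g (inj₁ q)) + ∑ (allPair m) (λ p → g (inj₂ p))
      ≈⟨ sym (∑-inj₁-inj₂ (allFin m) (allPair m) g) ⟩
    ∑ (allPair (suc m)) g ∎
    where
    open PairCount
    split = [ inj₁ , (λ r → inj₂ (toPair m r)) ]′

module Occurrences where
  open import Data.Nat using (_+_; _≤_)
  open import Data.Fin.Subset using (∣_∣)
  open import Data.Bool using (if_then_else_)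
  open ≡ using (refl; sym; trans; cong)

  count : ∀ {K m} → Fin K → Vec (Fin K) m → ℕ
  count v []      = 0
  count v (x ∷ t) = if does (x Fin.≟ v) then suc (count v t) else count v t

  count-yes : ∀ {K m} (v x : Fin K) (t : Vec (Fin K) m) → x ≡ v → count v (x ∷ t) ≡ suc (count v t)
  count-yes v x t e with x Fin.≟ v
  ... | yes _ = refl
  ... | no  x≢v = ⊥-elim (x≢v e)

  count-no : ∀ {K m} (v x : Fin K) (t : Vec (Fin K) m) → x ≢ v → count v (x ∷ t) ≡ count v t
  count-no v x t x≢v with x Fin.≟ v
  ... | yes e = ⊥-elim (x≢v e)
  ... | no  _ = refl

  count-≤ : ∀ {K m} (v : Fin K) (t : Vec (Fin K) m) → count v t ≤ m
  count-≤ v []      = z≤n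
  count-≤ v (x ∷ t) with x Fin.≟ v
  ... | yes _ = s≤s (count-≤ v t)
  ... | no  _ = ℕₚ.m≤n⇒m≤1+n (count-≤ v t)

  count₂-≤ : ∀ {K m} {v d : Fin K} (t : Vec (Fin K) m) → v ≢ d → count v t + count d t ≤ m
  count₂-≤ []                 _   = z≤n
  count₂-≤ {v = v} {d} (x ∷ t) v≢d with x Fin.≟ v | x Fin.≟ d
  ... | yes refl | yes refl = ⊥-elim (v≢d refl)
  ... | yes _    | no _     = s≤s (count₂-≤ t v≢d)
  ... | no _     | yes _    = ℕₚ.≤-trans (ℕₚ.≤-reflexive (ℕₚ.+-suc (count v t) (count d t))) (s≤s (count₂-≤ t v≢d))
  ... | no _     | no _     = ℕₚ.m≤n⇒m≤1+n (count₂-≤ t v≢d)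

  count₃-≤ : ∀ {K m} {v w d : Fin K} (t : Vec (Fin K) m) → v ≢ w → v ≢ d → w ≢ d →
    count v t + count w t + count d t ≤ m
  count₃-≤ [] _ _ _ = z≤n
  count₃-≤ {v = v} {w} {d} (x ∷ t) v≢w v≢d w≢d with x Fin.≟ v | x Fin.≟ w | x Fin.≟ d
  ... | yes refl | yes refl | _        = ⊥-elim (v≢w refl)
  ... | yes refl | no _     | yes refl = ⊥-elim (v≢d refl)
  ... | no _     | yes refl | yes refl = ⊥-elim (w≢d refl)
  ... | yes _    | no _     | no _     = s≤s (count₃-≤ t v≢w v≢d w≢d)
  ... | no _     | yes _    | no _     =
    ℕₚ.≤-trans (ℕₚ.≤-reflexive (cong (_+ count d t) (ℕₚ.+-suc (count v t) (count w t)))) (s≤s (count₃-≤ t v≢w v≢d w≢d))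
  ... | no _     | no _     | yes _    =
    ℕₚ.≤-trans (ℕₚ.≤-reflexive (ℕₚ.+-suc (count v t + count w t) (count d t))) (s≤s (count₃-≤ t v≢w v≢d w≢d))
  ... | no _     | no _     | no _     = ℕₚ.m≤n⇒m≤1+n (count₃-≤ t v≢w v≢d w≢d)

  count-total₂ : ∀ {m} (t : Vec (Fin 2) m) → count zero t + count 𝟙 t ≡ m
  count-total₂ []       = refl
  count-total₂ (zero ∷ t) = cong suc (count-total₂ t)
  count-total₂ (𝟙 ∷ t)    = trans (ℕₚ.+-suc _ _) (cong suc (count-total₂ t))

  count-total₃ : ∀ {m} (t : Vec (Fin 3) m) → count zero t + count 𝟙 t + count 𝟚 t ≡ m
  count-total₃ []       = refl
  count-total₃ (zero ∷ t) = cong suc (count-total₃ t)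
  count-total₃ (𝟙 ∷ t)    = trans (cong (_+ count 𝟚 t) (ℕₚ.+-suc (count zero t) (count 𝟙 t))) (cong suc (count-total₃ t))
  count-total₃ (𝟚 ∷ t)    = trans (ℕₚ.+-suc _ _) (cong suc (count-total₃ t))

  count-total₄ : ∀ {m} (t : Vec (Fin 4) m) → count zero t + count 𝟙 t + count 𝟚 t + count 𝟛 t ≡ m
  count-total₄ []       = refl
  count-total₄ (zero ∷ t) = cong suc (count-total₄ t)
  count-total₄ (𝟙 ∷ t)    =
    trans (cong (λ z → z + count 𝟚 t + count 𝟛 t) (ℕₚ.+-suc (count zero t) (count 𝟙 t))) (cong suc (count-total₄ t))
  count-total₄ (𝟚 ∷ t)    =
    trans (cong (_+ count 𝟛 t) (ℕₚ.+-suc (count zero t + count 𝟙 t) (count 𝟚 t))) (cong suc (count-total₄ t))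
  count-total₄ (𝟛 ∷ t)    = trans (ℕₚ.+-suc _ _) (cong suc (count-total₄ t))

  ∣block∣≡count : ∀ {K m} (σ : Vec (Fin K) m) v → ∣ block σ v ∣ ≡ count v σ
  ∣block∣≡count []      v = refl
  ∣block∣≡count (x ∷ σ) v with x Fin.≟ v
  ... | yes _ = cong suc (∣block∣≡count σ v)
  ... | no  _ = ∣block∣≡count σ v

  lookup⇒count : ∀ {K m} (σ : Vec (Fin K) m) (i : Fin m) {v} → lookup σ i ≡ v → 1 ≤ count v σ
  lookup⇒count (x ∷ σ) zero    e = ℕₚ.≤-trans (s≤s z≤n) (ℕₚ.≤-reflexive (sym (count-yes _ x σ e)))
  lookup⇒count (x ∷ σ) (suc i) {v} e with x Fin.≟ v
  ... | yes _ = s≤s z≤n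
  ... | no  _ = lookup⇒count σ i e

  count⇒lookup : ∀ {K m} (σ : Vec (Fin K) m) v → 1 ≤ count v σ → ∃ λ i → lookup σ i ≡ v
  count⇒lookup (x ∷ σ) v h with x Fin.≟ v
  ... | yes e = zero , e
  ... | no  _ with count⇒lookup σ v h
  ...   | i , e = suc i , e

  block-⊆ : ∀ {K K′ m} (σ : Vec (Fin K) m) (τ : Vec (Fin K′) m) v w →
    (∀ i → lookup σ i ≡ v → lookup τ i ≡ w) → block σ v ⊆ block τ w
  block-⊆ σ τ v w h {i} i∈ =
    Vecₚ.lookup⇒[]= i (block τ w)
      (trans (Vecₚ.lookup-map i _ τ) (≟-true (h i (≟-true⁻¹ (trans (sym (Vecₚ.lookup-map i _ σ)) (Vecₚ.[]=⇒lookup i∈))))))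
    where
    ≟-true : ∀ {K} {a b : Fin K} → a ≡ b → does (a Fin.≟ b) ≡ true
    ≟-true {a = a} {b} e with a Fin.≟ b
    ... | yes _ = refl
    ... | no a≢b = ⊥-elim (a≢b e)
    ≟-true⁻¹ : ∀ {K} {a b : Fin K} → does (a Fin.≟ b) ≡ true → a ≡ b
    ≟-true⁻¹ {a = a} {b} e with a Fin.≟ b
    ... | yes a≡b = a≡b
    ... | no _ with e
    ...   | ()

module Patterns where
  open import Data.Nat using (_+_)
  open ≡ using (refl; sym; trans; cong)
  open Occurrences

  oneHot : ∀ {K m} → Fin K → Fin K → Fin m → Vec (Fin K) m
  oneHot {m = suc m} v d zero    = v ∷ replicate m d
  oneHot             v d (suc b) = d ∷ oneHot v d b

  twoHot : ∀ {K m} → Fin K → Fin K → Fin K → Pair m → Vec (Fin K) m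
  twoHot {m = suc m} v w d (inj₁ q) = v ∷ oneHot w d q
  twoHot {m = suc m} v w d (inj₂ p) = d ∷ twoHot v w d p

  map-oneHot : ∀ {K K′ m} (f : Fin K → Fin K′) v d (b : Fin m) → Vec.map f (oneHot v d b) ≡ oneHot (f v) (f d) b
  map-oneHot {m = suc m} f v d zero    = cong (f v ∷_) (Vecₚ.map-replicate f d m)
  map-oneHot             f v d (suc b) = cong (f d ∷_) (map-oneHot f v d b)

  map-twoHot : ∀ {K K′ m} (f : Fin K → Fin K′) v w d (p : Pair m) → Vec.map f (twoHot v w d p) ≡ twoHot (f v) (f w) (f d) p
  map-twoHot {m = suc m} f v w d (inj₁ q) = cong (f v ∷_) (map-oneHot f w d q)
  map-twoHot {m = suc m} f v w d (inj₂ p) = cong (f d ∷_) (map-twoHot f v w d p)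

  oneHot-same : ∀ {K m} (d : Fin K) (b : Fin m) → oneHot d d b ≡ replicate m d
  oneHot-same d zero    = refl
  oneHot-same d (suc b) = cong (d ∷_) (oneHot-same d b)

  twoHot≡oneHot-larger : ∀ {K m} (w d : Fin K) (p : Pair m) → twoHot d w d p ≡ oneHot w d (larger p)
  twoHot≡oneHot-larger {m = suc m} w d (inj₁ q) = refl
  twoHot≡oneHot-larger {m = suc m} w d (inj₂ p) = cong (d ∷_) (twoHot≡oneHot-larger w d p)

  twoHot≡oneHot-smaller : ∀ {K m} (v d : Fin K) (p : Pair m) → twoHot v d d p ≡ oneHot v d (smaller p)
  twoHot≡oneHot-smaller {m = suc m} v d (inj₁ q) = cong (v ∷_) (oneHot-same d q)
  twoHot≡oneHot-smaller {m = suc m} v d (inj₂ p) = cong (d ∷_) (twoHot≡oneHot-smaller v d p)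

  lookup-oneHot-≡ : ∀ {K m} (v d : Fin K) (b : Fin m) → lookup (oneHot v d b) b ≡ v
  lookup-oneHot-≡ v d zero    = refl
  lookup-oneHot-≡ v d (suc b) = lookup-oneHot-≡ v d b

  lookup-oneHot-≢ : ∀ {K m} (v d : Fin K) {b i : Fin m} → b ≢ i → lookup (oneHot v d b) i ≡ d
  lookup-oneHot-≢ v d {zero}  {zero}  b≢i = ⊥-elim (b≢i refl)
  lookup-oneHot-≢ v d {zero}  {suc i} b≢i = Vecₚ.lookup-replicate i d
  lookup-oneHot-≢ v d {suc b} {zero}  b≢i = refl
  lookup-oneHot-≢ v d {suc b} {suc i} b≢i = lookup-oneHot-≢ v d (λ e → b≢i (cong suc e))

  count-replicate : ∀ {K} m (d : Fin K) → count d (replicate m d) ≡ m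
  count-replicate zero    d = refl
  count-replicate (suc m) d = trans (count-yes d d (replicate m d) refl) (cong suc (count-replicate m d))

  count-replicate-≢ : ∀ {K} m (x d : Fin K) → d ≢ x → count x (replicate m d) ≡ 0
  count-replicate-≢ zero    x d d≢x = refl
  count-replicate-≢ (suc m) x d d≢x = trans (count-no x d (replicate m d) d≢x) (count-replicate-≢ m x d d≢x)

  count-oneHot-hot : ∀ {K m} (v d : Fin K) (b : Fin m) → d ≢ v → count v (oneHot v d b) ≡ 1
  count-oneHot-hot {m = suc m} v d zero    d≢v =
    trans (count-yes v v (replicate m d) refl) (cong suc (count-replicate-≢ m v d d≢v))
  count-oneHot-hot             v d (suc b) d≢v = trans (count-no v d (oneHot v d b) d≢v) (count-oneHot-hot v d b d≢v)

  count-oneHot-cold : ∀ {K m} (v d : Fin K) (b : Fin (suc m)) → v ≢ d → count d (oneHot v d b) ≡ m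
  count-oneHot-cold {m = m}     v d zero    v≢d = trans (count-no d v (replicate m d) v≢d) (count-replicate m d)
  count-oneHot-cold {m = suc m} v d (suc b) v≢d =
    trans (count-yes d d (oneHot v d b) refl) (cong suc (count-oneHot-cold v d b v≢d))

  count-oneHot-other : ∀ {K m} (x v d : Fin K) (b : Fin m) → v ≢ x → d ≢ x → count x (oneHot v d b) ≡ 0
  count-oneHot-other {m = suc m} x v d zero    v≢x d≢x =
    trans (count-no x v (replicate m d) v≢x) (count-replicate-≢ m x d d≢x)
  count-oneHot-other             x v d (suc b) v≢x d≢x =
    trans (count-no x d (oneHot v d b) d≢x) (count-oneHot-other x v d b v≢x d≢x)

  count-twoHot-cold : ∀ {K m} (v w d : Fin K) (p : Pair m) → v ≢ d → w ≢ d → 2 + count d (twoHot v w d p) ≡ m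
  count-twoHot-cold {m = suc zero}    v w d (inj₁ ())
  count-twoHot-cold {m = suc (suc m)} v w d (inj₁ q) v≢d w≢d =
    cong (2 +_) (trans (count-no d v (oneHot w d q) v≢d) (count-oneHot-cold w d q w≢d))
  count-twoHot-cold {m = suc m}       v w d (inj₂ p) v≢d w≢d =
    trans (cong (2 +_) (count-yes d d (twoHot v w d p) refl)) (cong suc (count-twoHot-cold v w d p v≢d w≢d))

  count-twoHot-smaller : ∀ {K m} (v w d : Fin K) (p : Pair m) → w ≢ v → d ≢ v → count v (twoHot v w d p) ≡ 1
  count-twoHot-smaller {m = suc m} v w d (inj₁ q) w≢v d≢v =
    trans (count-yes v v (oneHot w d q) refl) (cong suc (count-oneHot-other v w d q w≢v d≢v))
  count-twoHot-smaller {m = suc m} v w d (inj₂ p) w≢v d≢v =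
    trans (count-no v d (twoHot v w d p) d≢v) (count-twoHot-smaller v w d p w≢v d≢v)

  count-twoHot-larger : ∀ {K m} (v w d : Fin K) (p : Pair m) → v ≢ w → d ≢ w → count w (twoHot v w d p) ≡ 1
  count-twoHot-larger {m = suc m} v w d (inj₁ q) v≢w d≢w = trans (count-no w v (oneHot w d q) v≢w) (count-oneHot-hot w d q d≢w)
  count-twoHot-larger {m = suc m} v w d (inj₂ p) v≢w d≢w =
    trans (count-no w d (twoHot v w d p) d≢w) (count-twoHot-larger v w d p v≢w d≢w)

  count-twoHot-both : ∀ {K m} (v d : Fin K) (p : Pair m) → d ≢ v → count v (twoHot v v d p) ≡ 2
  count-twoHot-both {m = suc m} v d (inj₁ q) d≢v = trans (count-yes v v (oneHot v d q) refl) (cong suc (count-oneHot-hot v d q d≢v))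
  count-twoHot-both {m = suc m} v d (inj₂ p) d≢v = trans (count-no v d (twoHot v v d p) d≢v) (count-twoHot-both v d p d≢v)

  oneHot-injective : ∀ {K m} {v d : Fin K} (b b′ : Fin m) → v ≢ d → oneHot v d b ≡ oneHot v d b′ → b ≡ b′
  oneHot-injective zero    zero     v≢d e = refl
  oneHot-injective zero    (suc b′) v≢d e = ⊥-elim (v≢d (Vecₚ.∷-injectiveˡ e))
  oneHot-injective (suc b) zero     v≢d e = ⊥-elim (v≢d (sym (Vecₚ.∷-injectiveˡ e)))
  oneHot-injective (suc b) (suc b′) v≢d e = cong suc (oneHot-injective b b′ v≢d (Vecₚ.∷-injectiveʳ e))

  twoHot-injective : ∀ {K m} {v w d : Fin K} (p p′ : Pair m) → v ≢ d → w ≢ d → twoHot v w d p ≡ twoHot v w d p′ → p ≡ p′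
  twoHot-injective {m = suc m} (inj₁ q) (inj₁ q′) v≢d w≢d e = cong inj₁ (oneHot-injective q q′ w≢d (Vecₚ.∷-injectiveʳ e))
  twoHot-injective {m = suc m} (inj₁ q) (inj₂ p′) v≢d w≢d e = ⊥-elim (v≢d (Vecₚ.∷-injectiveˡ e))
  twoHot-injective {m = suc m} (inj₂ p) (inj₁ q′) v≢d w≢d e = ⊥-elim (v≢d (sym (Vecₚ.∷-injectiveˡ e)))
  twoHot-injective {m = suc m} (inj₂ p) (inj₂ p′) v≢d w≢d e = cong inj₂ (twoHot-injective p p′ v≢d w≢d (Vecₚ.∷-injectiveʳ e))

  twoHot≢twoHot-swapped : ∀ {K m} {v w d : Fin K} (p p′ : Pair m) → v ≢ w → v ≢ d → w ≢ d → twoHot v w d p ≢ twoHot w v d p′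
  twoHot≢twoHot-swapped {m = suc m} (inj₁ q) (inj₁ q′) v≢w v≢d w≢d e = v≢w (Vecₚ.∷-injectiveˡ e)
  twoHot≢twoHot-swapped {m = suc m} (inj₁ q) (inj₂ p′) v≢w v≢d w≢d e = v≢d (Vecₚ.∷-injectiveˡ e)
  twoHot≢twoHot-swapped {m = suc m} (inj₂ p) (inj₁ q′) v≢w v≢d w≢d e = w≢d (sym (Vecₚ.∷-injectiveˡ e))
  twoHot≢twoHot-swapped {m = suc m} (inj₂ p) (inj₂ p′) v≢w v≢d w≢d e =
    twoHot≢twoHot-swapped p p′ v≢w v≢d w≢d (Vecₚ.∷-injectiveʳ e)

  replicate-of-count : ∀ {K m} (d : Fin K) (t : Vec (Fin K) m) → count d t ≡ m → t ≡ replicate m d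
  replicate-of-count d []      e = refl
  replicate-of-count d (x ∷ t) e with x Fin.≟ d
  ... | yes refl = cong (x ∷_) (replicate-of-count d t (ℕₚ.suc-injective e))
  ... | no  _    = ⊥-elim (ℕₚ.<-irrefl e (s≤s (count-≤ d t)))

  oneHot-of-count : ∀ {K m} (v d : Fin K) (t : Vec (Fin K) m) → v ≢ d → count v t ≡ 1 → count v t + count d t ≡ m →
    ∃ λ b → t ≡ oneHot v d b
  oneHot-of-count v d (x ∷ t) v≢d e₁ e₂ with x Fin.≟ v | x Fin.≟ d
  ... | yes refl | yes refl = ⊥-elim (v≢d refl)
  ... | yes refl | no _     =
    zero , cong (x ∷_) (replicate-of-count d t (ℕₚ.suc-injective (trans (sym (cong (λ z → suc (z + count d t)) (ℕₚ.suc-injective e₁))) e₂)))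
  ... | no _     | yes refl with oneHot-of-count v d t v≢d e₁ (ℕₚ.suc-injective (trans (sym (ℕₚ.+-suc (count v t) (count d t))) e₂))
  ...   | b , eb = suc b , cong (x ∷_) eb
  oneHot-of-count v d (x ∷ t) v≢d e₁ e₂ | no _ | no _ = ⊥-elim (ℕₚ.<-irrefl e₂ (s≤s (count₂-≤ t v≢d)))

  twoHot-both-of-count : ∀ {K m} (v d : Fin K) (t : Vec (Fin K) m) → v ≢ d → count v t ≡ 2 → count v t + count d t ≡ m →
    ∃ λ (p : Pair m) → t ≡ twoHot v v d p
  twoHot-both-of-count v d (x ∷ t) v≢d e₁ e₂ with x Fin.≟ v | x Fin.≟ d
  ... | yes refl | yes refl = ⊥-elim (v≢d refl)
  ... | yes refl | no _ with oneHot-of-count v d t v≢d (ℕₚ.suc-injective e₁) (ℕₚ.suc-injective e₂)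
  ...   | q , eq = inj₁ q , cong (x ∷_) eq
  twoHot-both-of-count v d (x ∷ t) v≢d e₁ e₂ | no _ | yes refl
    with twoHot-both-of-count v d t v≢d e₁ (ℕₚ.suc-injective (trans (sym (ℕₚ.+-suc (count v t) (count d t))) e₂))
  ...   | p , ep = inj₂ p , cong (x ∷_) ep
  twoHot-both-of-count v d (x ∷ t) v≢d e₁ e₂ | no _ | no _ = ⊥-elim (ℕₚ.<-irrefl e₂ (s≤s (count₂-≤ t v≢d)))

  drop-zero-middle : ∀ a c {b m} → b ≡ 0 → a + suc b + c ≡ suc m → a + c ≡ m
  drop-zero-middle a c refl e = ℕₚ.suc-injective (trans (cong (_+ c) (sym (trans (ℕₚ.+-suc a 0) (cong suc (ℕₚ.+-identityʳ a))))) e)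

  twoHot-of-count : ∀ {K m} (v w d : Fin K) (t : Vec (Fin K) m) → v ≢ w → v ≢ d → w ≢ d →
    count v t ≡ 1 → count w t ≡ 1 → count v t + count w t + count d t ≡ m →
    ∃ λ (p : Pair m) → (t ≡ twoHot v w d p) ⊎ (t ≡ twoHot w v d p)
  twoHot-of-count v w d (x ∷ t) v≢w v≢d w≢d e₁ e₂ e₃ with x Fin.≟ v | x Fin.≟ w | x Fin.≟ d
  ... | yes refl | yes refl | _        = ⊥-elim (v≢w refl)
  ... | yes refl | no _     | yes refl = ⊥-elim (v≢d refl)
  ... | no _     | yes refl | yes refl = ⊥-elim (w≢d refl)
  ... | yes refl | no _     | no _
    with oneHot-of-count w d t w≢d e₂ (ℕₚ.suc-injective (trans (cong (λ z → suc (z + count w t + count d t)) (sym (ℕₚ.suc-injective e₁))) e₃))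
  ...   | q , eq = inj₁ q , inj₁ (cong (x ∷_) eq)
  twoHot-of-count v w d (x ∷ t) v≢w v≢d w≢d e₁ e₂ e₃ | no _ | yes refl | no _
    with oneHot-of-count v d t v≢d e₁ (drop-zero-middle (count v t) (count d t) (ℕₚ.suc-injective e₂) e₃)
  ...   | q , eq = inj₁ q , inj₂ (cong (x ∷_) eq)
  twoHot-of-count v w d (x ∷ t) v≢w v≢d w≢d e₁ e₂ e₃ | no _ | no _ | yes refl
    with twoHot-of-count v w d t v≢w v≢d w≢d e₁ e₂ (ℕₚ.suc-injective (trans (sym (ℕₚ.+-suc (count v t + count w t) (count d t))) e₃))
  ...   | p , inj₁ ep = inj₂ p , inj₁ (cong (x ∷_) ep)
  ...   | p , inj₂ ep = inj₂ p , inj₂ (cong (x ∷_) ep)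
  twoHot-of-count v w d (x ∷ t) v≢w v≢d w≢d e₁ e₂ e₃ | no _ | no _ | no _ = ⊥-elim (ℕₚ.<-irrefl e₃ (s≤s (count₃-≤ t v≢w v≢d w≢d)))

⊎-injective : ∀ {A B C : Set} {f : A → C} {g : B → C} →
  (∀ a a′ → f a ≡ f a′ → a ≡ a′) → (∀ b b′ → g b ≡ g b′ → b ≡ b′) → (∀ a b → f a ≢ g b) →
  ∀ x y → [ f , g ]′ x ≡ [ f , g ]′ y → x ≡ y
⊎-injective f-inj g-inj f≢g (inj₁ a) (inj₁ a′) e = ≡.cong inj₁ (f-inj a a′ e)
⊎-injective f-inj g-inj f≢g (inj₁ a) (inj₂ b)  e = ⊥-elim (f≢g a b e)
⊎-injective f-inj g-inj f≢g (inj₂ b) (inj₁ a)  e = ⊥-elim (f≢g a b (≡.sym e))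
⊎-injective f-inj g-inj f≢g (inj₂ b) (inj₂ b′) e = ≡.cong inj₂ (g-inj b b′ e)

Vec-Fin1-irrelevant : ∀ {m} (a b : Vec (Fin 1) m) → a ≡ b
Vec-Fin1-irrelevant []         []         = ≡.refl
Vec-Fin1-irrelevant (zero ∷ a) (zero ∷ b) = ≡.cong (zero ∷_) (Vec-Fin1-irrelevant a b)

-- The faces of a three-block partition (B₁, B₂, B₃): merge₀ gives (B₁, B₂ ∪ B₃), merge₁ gives (B₁ ∪ B₂, B₃) and
-- mergeLast gives (B₁ ∪ B₃, B₂).
merge₀ merge₁ mergeLast : ∀ {n} → Assign 3 n → Assign 2 n
merge₀    σ = Vec.map (pinch zero) σ
merge₁    σ = Vec.map (pinch 𝟙) σ
mergeLast σ = Vec.map joinLast σ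

module ChainComplex {c ℓ} (F : Field c ℓ) {n : ℕ} (H : Hypergraph n) where
  open Field F hiding (zero)
  open ListSums commutativeRing
  open Complex F H
  open import Algebra.Properties.Ring ring using (-‿distribʳ-*; -1*x≈-x; -‿involutive; -0#≈0#)
  open import Algebra.Properties.CommutativeSemigroup *-commutativeSemigroup using (x∙yz≈y∙xz)
  open import Relation.Binary.Reasoning.Setoid setoid

  δ : ∀ {K} → Assign K n → Assign K n → Carrier
  δ β σ = select (β ≟ᵛ σ) 1#

  δ-refl : ∀ {K} (β : Assign K n) → δ β β ≈ 1#
  δ-refl β = select-yes (β ≟ᵛ β) ≡.refl 1#

  δ-≢ : ∀ {K} {β σ : Assign K n} → β ≢ σ → δ β σ ≈ 0#
  δ-≢ {β = β} {σ} β≢σ = select-no (β ≟ᵛ σ) β≢σ 1#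

  δ-injective : ∀ {K} {I : Set} (_≟_ : DecidableEquality I) (pt : I → Assign K n) →
    (∀ i j → pt i ≡ pt j → i ≡ j) → ∀ i j → δ (pt i) (pt j) ≈ select (j ≟ i) 1#
  δ-injective _≟_ pt pt-inj i j =
    select-iff (pt i ≟ᵛ pt j) (j ≟ i) (λ e → ≡.sym (pt-inj i j e)) (λ e → ≡.cong pt (≡.sym e)) 1#

  δ-supported : ∀ {m} (β : Assign (suc m) n) → InΔ H β → Supported (δ β)
  δ-supported β β∈Δ σ σ∉Δ = δ-≢ (λ e → σ∉Δ (≡.subst (InΔ H) e β∈Δ))

  ∑-δ-sifting : ∀ {K} {I : Set} {_≟_ : DecidableEquality I} {xs} → Sifting _≟_ xs →
    (a : I → Carrier) (pt : I → Assign K n) → (∀ i j → pt i ≡ pt j → i ≡ j) →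
    ∀ j → ∑ xs (λ i → a i * δ (pt i) (pt j)) ≈ a j
  ∑-δ-sifting {_≟_ = _≟_} {xs} xs-sift a pt pt-inj j =
    trans (∑-cong xs (λ i → trans (*-congˡ (δ-injective _≟_ pt pt-inj i j)) (sym (select-* (j ≟ i) (a i)))))
          (xs-sift .sift j a)

  supported-expansion : ∀ {m} {I : Set} {_≟_ : DecidableEquality I} {xs} → Sifting _≟_ xs →
    (pt : I → Assign (suc m) n) → (∀ i j → pt i ≡ pt j → i ≡ j) → (∀ i → InΔ H (pt i)) →
    (∀ σ → (∃ λ i → pt i ≡ σ) ⊎ ¬ InΔ H σ) →
    ∀ x → Supported x → ∀ σ → x σ ≈ ∑ xs (λ i → x (pt i) * δ (pt i) σ)
  supported-expansion {xs = xs} xs-sift pt pt-inj pt∈Δ classify x x-supp σ with classify σ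
  ... | inj₁ (j , ≡.refl) = sym (∑-δ-sifting xs-sift (λ i → x (pt i)) pt pt-inj j)
  ... | inj₂ σ∉Δ = trans (x-supp σ σ∉Δ)
                     (sym (∑-zero xs (λ i → trans (*-congˡ (δ-supported (pt i) (pt∈Δ i) σ σ∉Δ)) (zeroʳ _))))

  incidence : ∀ m → Assign (suc (suc m)) n → Assign (suc m) n → Carrier
  incidence m σ τ = ∑ (allFin (suc m)) (λ i → sign (toℕ i) (δ (Vec.map (pinch i) σ) τ))
                  + sign (suc m) (δ (Vec.map joinLast σ) τ)

  sign-cong : ∀ k {x y} → x ≈ y → sign k x ≈ sign k y
  sign-cong zero    e = e
  sign-cong (suc k) e = -‿cong (sign-cong k e)

  sign-*ʳ : ∀ k v y → sign k (v * y) ≈ v * sign k y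
  sign-*ʳ zero    v y = refl
  sign-*ʳ (suc k) v y = trans (-‿cong (sign-*ʳ k v y)) (-‿distribʳ-* v (sign k y))

  ∑-sign : ∀ {A : Set} k (xs : List A) f → ∑ xs (λ a → sign k (f a)) ≈ sign k (∑ xs f)
  ∑-sign zero    xs f = refl
  ∑-sign (suc k) xs f = trans (∑-neg xs _) (-‿cong (∑-sign k xs f))

  ∂≈∑-incidence : ∀ m (x : Chain (suc m)) τ → ∂ m x τ ≈ ∑ (allAssign (suc (suc m)) n) (λ σ → x σ * incidence m σ τ)
  ∂≈∑-incidence m x τ = ∑-cong (allAssign (suc (suc m)) n) λ σ → begin
    ∑ (allFin (suc m)) (λ i → sign (toℕ i) (hit (Vec.map (pinch i) σ) τ (x σ)))
      + sign (suc m) (hit (Vec.map joinLast σ) τ (x σ))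
      ≈⟨ +-cong (∑-cong (allFin (suc m)) (λ i → sign-cong (toℕ i) (hit≈*δ (Vec.map (pinch i) σ) (x σ))))
                (sign-cong (suc m) (hit≈*δ (Vec.map joinLast σ) (x σ))) ⟩
    ∑ (allFin (suc m)) (λ i → sign (toℕ i) (x σ * δ (Vec.map (pinch i) σ) τ))
      + sign (suc m) (x σ * δ (Vec.map joinLast σ) τ)
      ≈⟨ +-cong (∑-cong (allFin (suc m)) (λ i → sign-*ʳ (toℕ i) (x σ) _)) (sign-*ʳ (suc m) (x σ) _) ⟩
    ∑ (allFin (suc m)) (λ i → x σ * sign (toℕ i) (δ (Vec.map (pinch i) σ) τ))
      + x σ * sign (suc m) (δ (Vec.map joinLast σ) τ)
      ≈⟨ +-congʳ (∑-*ˡ (allFin (suc m)) (x σ) _) ⟩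
    x σ * ∑ (allFin (suc m)) (λ i → sign (toℕ i) (δ (Vec.map (pinch i) σ) τ))
      + x σ * sign (suc m) (δ (Vec.map joinLast σ) τ)
      ≈⟨ sym (distribˡ (x σ) _ _) ⟩
    x σ * incidence m σ τ ∎
    where
    hit≈*δ : ∀ (σ′ : Assign (suc m) n) v → hit σ′ τ v ≈ v * δ σ′ τ
    hit≈*δ σ′ v with Vecₚ.≡-dec Fin._≟_ σ′ τ
    ... | yes _ = sym (*-identityʳ v)
    ... | no  _ = sym (zeroʳ v)

  ∂-zero : ∀ m {x : Chain (suc m)} → (∀ σ → x σ ≈ 0#) → ∀ τ → ∂ m x τ ≈ 0#
  ∂-zero m {x} x≈0 τ =
    trans (∂≈∑-incidence m x τ) (∑-zero (allAssign (suc (suc m)) n) (λ σ → trans (*-congʳ (x≈0 σ)) (zeroˡ _)))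

  ∂-∑δ : ∀ m {I : Set} (xs : List I) (a : I → Carrier) (pt : I → Assign (suc (suc m)) n) (x : Chain (suc m)) →
    (∀ σ → x σ ≈ ∑ xs (λ i → a i * δ (pt i) σ)) → ∀ τ → ∂ m x τ ≈ ∑ xs (λ i → a i * incidence m (pt i) τ)
  ∂-∑δ m xs a pt x x≈ τ = begin
    ∂ m x τ                                                          ≈⟨ ∂≈∑-incidence m x τ ⟩
    ∑ As (λ σ → x σ * incidence m σ τ)                               ≈⟨ ∑-cong As (λ σ → *-congʳ (x≈ σ)) ⟩
    ∑ As (λ σ → ∑ xs (λ i → a i * δ (pt i) σ) * incidence m σ τ)     ≈⟨ ∑-cong As (λ σ → sym (∑-*ʳ xs _ _)) ⟩
    ∑ As (λ σ → ∑ xs (λ i → a i * δ (pt i) σ * incidence m σ τ))     ≈⟨ ∑-comm As xs _ ⟩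
    ∑ xs (λ i → ∑ As (λ σ → a i * δ (pt i) σ * incidence m σ τ))
      ≈⟨ ∑-cong xs (λ i → trans (∑-cong As (λ σ → *-assoc _ _ _)) (∑-*ˡ As (a i) _)) ⟩
    ∑ xs (λ i → a i * ∑ As (λ σ → δ (pt i) σ * incidence m σ τ))
      ≈⟨ ∑-cong xs (λ i → *-congˡ (sifted (pt i))) ⟩
    ∑ xs (λ i → a i * incidence m (pt i) τ) ∎
    where
    As = allAssign (suc (suc m)) n
    sifted : ∀ β → ∑ As (λ σ → δ β σ * incidence m σ τ) ≈ incidence m β τ
    sifted β = trans (∑-cong As (λ σ → trans (*-comm _ _) (sym (select-* (β ≟ᵛ σ) _))))
                     (sifting-allAssign (suc (suc m)) n .sift β (λ σ → incidence m σ τ))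

  ∂-δ-δ : ∀ m (β β′ : Assign (suc (suc m)) n) τ →
    ∂ m (λ σ → δ β σ - δ β′ σ) τ ≈ incidence m β τ - incidence m β′ τ
  ∂-δ-δ m β β′ τ = begin
    ∂ m (λ σ → δ β σ - δ β′ σ) τ
      ≈⟨ ∂-∑δ m (true List.∷ false List.∷ List.[]) a pt _
           (λ σ → +-cong (sym (*-identityˡ _)) (trans (sym (-1*x≈-x _)) (sym (+-identityʳ _)))) τ ⟩
    1# * incidence m β τ + (- 1# * incidence m β′ τ + 0#)
      ≈⟨ +-cong (*-identityˡ _) (trans (+-identityʳ _) (-1*x≈-x _)) ⟩
    incidence m β τ - incidence m β′ τ ∎
    where
    a : Bool → Carrier
    a true  = 1#
    a false = - 1#
    pt : Bool → Assign (suc (suc m)) n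
    pt true  = β
    pt false = β′

  ⟪_,_⟫ : ∀ {m} → (Assign (suc m) n → Carrier) → Chain m → Carrier
  ⟪ g , y ⟫ = ∑ (allAssign _ n) (λ τ → g τ * y τ)

  coboundary : ∀ m → (Assign (suc m) n → Carrier) → Assign (suc (suc m)) n → Carrier
  coboundary m g σ = ∑ (allFin (suc m)) (λ i → sign (toℕ i) (g (Vec.map (pinch i) σ)))
                   + sign (suc m) (g (Vec.map joinLast σ))

  ∑-*-incidence : ∀ m (g : Assign (suc m) n → Carrier) σ →
    ∑ (allAssign (suc m) n) (λ τ → g τ * incidence m σ τ) ≈ coboundary m g σ
  ∑-*-incidence m g σ = begin
    ∑ As (λ τ → g τ * incidence m σ τ)
      ≈⟨ ∑-cong As (λ τ → distribˡ (g τ) _ _) ⟩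
    ∑ As (λ τ → g τ * faces τ + g τ * sign (suc m) (δ (Vec.map joinLast σ) τ))
      ≈⟨ ∑-+ As _ _ ⟩
    ∑ As (λ τ → g τ * faces τ) + ∑ As (λ τ → g τ * sign (suc m) (δ (Vec.map joinLast σ) τ))
      ≈⟨ +-cong faces-part (signed-value (suc m) (Vec.map joinLast σ)) ⟩
    coboundary m g σ ∎
    where
    As = allAssign (suc m) n
    faces : Assign (suc m) n → Carrier
    faces τ = ∑ (allFin (suc m)) (λ i → sign (toℕ i) (δ (Vec.map (pinch i) σ) τ))
    signed-value : ∀ k β → ∑ As (λ τ → g τ * sign k (δ β τ)) ≈ sign k (g β)
    signed-value k β = begin
      ∑ As (λ τ → g τ * sign k (δ β τ))        ≈⟨ ∑-cong As (λ τ → sym (sign-*ʳ k (g τ) _)) ⟩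
      ∑ As (λ τ → sign k (g τ * δ β τ))        ≈⟨ ∑-cong As (λ τ → sign-cong k (sym (select-* (β ≟ᵛ τ) (g τ)))) ⟩
      ∑ As (λ τ → sign k (select (β ≟ᵛ τ) (g τ)))  ≈⟨ ∑-sign k As _ ⟩
      sign k (∑ As (λ τ → select (β ≟ᵛ τ) (g τ)))  ≈⟨ sign-cong k (sifting-allAssign (suc m) n .sift β g) ⟩
      sign k (g β) ∎
    faces-part : ∑ As (λ τ → g τ * faces τ) ≈ ∑ (allFin (suc m)) (λ i → sign (toℕ i) (g (Vec.map (pinch i) σ)))
    faces-part = begin
      ∑ As (λ τ → g τ * faces τ)
        ≈⟨ ∑-cong As (λ τ → sym (∑-*ˡ (allFin (suc m)) (g τ) _)) ⟩
      ∑ As (λ τ → ∑ (allFin (suc m)) (λ i → g τ * sign (toℕ i) (δ (Vec.map (pinch i) σ) τ)))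
        ≈⟨ ∑-comm As (allFin (suc m)) _ ⟩
      ∑ (allFin (suc m)) (λ i → ∑ As (λ τ → g τ * sign (toℕ i) (δ (Vec.map (pinch i) σ) τ)))
        ≈⟨ ∑-cong (allFin (suc m)) (λ i → signed-value (toℕ i) (Vec.map (pinch i) σ)) ⟩
      ∑ (allFin (suc m)) (λ i → sign (toℕ i) (g (Vec.map (pinch i) σ))) ∎

  ⟪⟫-∂ : ∀ m (g : Assign (suc m) n → Carrier) (w : Chain (suc m)) →
    ⟪ g , ∂ m w ⟫ ≈ ∑ (allAssign (suc (suc m)) n) (λ σ → w σ * coboundary m g σ)
  ⟪⟫-∂ m g w = begin
    ∑ As (λ τ → g τ * ∂ m w τ)                               ≈⟨ ∑-cong As (λ τ → *-congˡ (∂≈∑-incidence m w τ)) ⟩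
    ∑ As (λ τ → g τ * ∑ Bs (λ σ → w σ * incidence m σ τ))    ≈⟨ ∑-cong As (λ τ → sym (∑-*ˡ Bs (g τ) _)) ⟩
    ∑ As (λ τ → ∑ Bs (λ σ → g τ * (w σ * incidence m σ τ)))  ≈⟨ ∑-comm As Bs _ ⟩
    ∑ Bs (λ σ → ∑ As (λ τ → g τ * (w σ * incidence m σ τ)))
      ≈⟨ ∑-cong Bs (λ σ → trans (∑-cong As (λ τ → x∙yz≈y∙xz (g τ) (w σ) _)) (∑-*ˡ As (w σ) _)) ⟩
    ∑ Bs (λ σ → w σ * ∑ As (λ τ → g τ * incidence m σ τ))    ≈⟨ ∑-cong Bs (λ σ → *-congˡ (∑-*-incidence m g σ)) ⟩
    ∑ Bs (λ σ → w σ * coboundary m g σ) ∎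
    where
    As = allAssign (suc m) n
    Bs = allAssign (suc (suc m)) n

  incidence-faces : ∀ σ {a b d} → merge₀ σ ≡ a → merge₁ σ ≡ b → mergeLast σ ≡ d →
    ∀ τ → incidence 1 σ τ ≈ (δ a τ - δ b τ) + δ d τ
  incidence-faces σ ≡.refl ≡.refl ≡.refl τ = +-cong (+-congˡ (+-identityʳ _)) (-‿involutive _)

  coboundary-faces : ∀ g σ {a b d} → merge₀ σ ≡ a → merge₁ σ ≡ b → mergeLast σ ≡ d →
    coboundary 1 g σ ≈ (g a - g b) + g d
  coboundary-faces g σ ≡.refl ≡.refl ≡.refl = +-cong (+-congˡ (+-identityʳ _)) (-‿involutive _)

  inSecondBlock : Fin n → Assign 2 n → Carrier
  inSecondBlock i τ = select (lookup τ i Fin.≟ 𝟙) 1#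

  coboundary-inSecondBlock : ∀ i σ → coboundary 1 (inSecondBlock i) σ ≈ 0#
  coboundary-inSecondBlock i σ =
    trans (coboundary-faces (inSecondBlock i) σ ≡.refl ≡.refl ≡.refl)
      (trans (reflexive (≡.cong₂ (λ u v → (u - v) + inSecondBlock i (mergeLast σ)) (at (pinch zero)) (at (pinch 𝟙))))
        (trans (+-congˡ (reflexive (at joinLast))) (faces (lookup σ i))))
    where
    at : ∀ (f : Fin 3 → Fin 2) → inSecondBlock i (Vec.map f σ) ≡ select (f (lookup σ i) Fin.≟ 𝟙) 1#
    at f = ≡.cong (λ t → select (t Fin.≟ 𝟙) 1#) (Vecₚ.lookup-map i f σ)
    faces : ∀ v → (select (pinch zero v Fin.≟ 𝟙) 1# - select (pinch 𝟙 v Fin.≟ 𝟙) 1#) + select (joinLast v Fin.≟ 𝟙) 1# ≈ 0#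
    faces zero = trans (+-identityʳ _) (trans (+-identityˡ _) -0#≈0#)
    faces 𝟙    = trans (+-congʳ (+-identityˡ _)) (-‿inverseˡ 1#)
    faces 𝟚    = trans (+-identityʳ _) (-‿inverseʳ 1#)

  ⟪⟫-∑δ : ∀ {m} {I : Set} (g : Assign (suc m) n → Carrier) (xs : List I) (a : I → Carrier) (pt : I → Assign (suc m) n) →
    ⟪ g , (λ τ → ∑ xs (λ i → a i * δ (pt i) τ)) ⟫ ≈ ∑ xs (λ i → a i * g (pt i))
  ⟪⟫-∑δ {m} g xs a pt = begin
    ∑ As (λ τ → g τ * ∑ xs (λ i → a i * δ (pt i) τ))     ≈⟨ ∑-cong As (λ τ → sym (∑-*ˡ xs (g τ) _)) ⟩
    ∑ As (λ τ → ∑ xs (λ i → g τ * (a i * δ (pt i) τ)))   ≈⟨ ∑-comm As xs _ ⟩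
    ∑ xs (λ i → ∑ As (λ τ → g τ * (a i * δ (pt i) τ)))
      ≈⟨ ∑-cong xs (λ i → trans (∑-cong As (λ τ → x∙yz≈y∙xz (g τ) (a i) _)) (∑-*ˡ As (a i) _)) ⟩
    ∑ xs (λ i → a i * ∑ As (λ τ → g τ * δ (pt i) τ))
      ≈⟨ ∑-cong xs (λ i → *-congˡ (trans (∑-cong As (λ τ → sym (select-* (pt i ≟ᵛ τ) (g τ))))
                                          (sifting-allAssign (suc m) n .sift (pt i) g))) ⟩
    ∑ xs (λ i → a i * g (pt i)) ∎
    where As = allAssign (suc m) n

  ∂₀≈0 : ∀ (w : Chain 1) τ → ∂ 0 w τ ≈ 0#
  ∂₀≈0 w τ = ∑-zero (allAssign 2 n) λ σ → begin
    (hit {0} (Vec.map (pinch zero) σ) τ (w σ) + 0#) + - hit {0} (Vec.map joinLast σ) τ (w σ)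
      ≈⟨ +-congʳ (+-identityʳ _) ⟩
    hit {0} (Vec.map (pinch zero) σ) τ (w σ) + - hit {0} (Vec.map joinLast σ) τ (w σ)
      ≡⟨ ≡.cong (λ z → hit {0} z τ (w σ) + - hit {0} (Vec.map joinLast σ) τ (w σ))
                (Vec-Fin1-irrelevant (Vec.map (pinch zero) σ) (Vec.map joinLast σ)) ⟩
    hit {0} (Vec.map joinLast σ) τ (w σ) + - hit {0} (Vec.map joinLast σ) τ (w σ)
      ≈⟨ -‿inverseʳ _ ⟩
    0# ∎

  oneBlock : Assign 1 n
  oneBlock = replicate n zero

  one-block-homology : InΔ H oneBlock → HomologyDim 0 1
  one-block-homology oneBlock∈Δ = basis , (λ _ → δ-supported oneBlock oneBlock∈Δ , lift tt) , independent , spanning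
    where
    basis : Fin 1 → Chain 0
    basis _ = δ oneBlock
    independent : ∀ a → IsBoundary 0 (lin basis a) → ∀ i → a i ≈ 0#
    independent a (w , _ , a≈∂w) zero = begin
      a zero                        ≈⟨ sym (*-identityʳ _) ⟩
      a zero * 1#                   ≈⟨ *-congˡ (sym (δ-refl oneBlock)) ⟩
      a zero * δ oneBlock oneBlock  ≈⟨ sym (+-identityʳ _) ⟩
      lin basis a oneBlock          ≈⟨ a≈∂w oneBlock ⟩
      ∂ 0 w oneBlock                ≈⟨ ∂₀≈0 w oneBlock ⟩
      0#                            ∎
    spanning : ∀ x → Supported x → IsCycle 0 x → ∃ λ a → IsBoundary 0 (λ σ → x σ - lin basis a σ)
    spanning x _ _ = (λ _ → x oneBlock) , (λ _ → 0#) , (λ _ _ → refl) , λ τ → x-x≈∂0 τ (Vec-Fin1-irrelevant τ oneBlock)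
      where
      x-x≈∂0 : ∀ τ → τ ≡ oneBlock → x τ - lin basis (λ _ → x oneBlock) τ ≈ ∂ 0 (λ _ → 0#) τ
      x-x≈∂0 τ ≡.refl = begin
        x oneBlock - (x oneBlock * δ oneBlock oneBlock + 0#)
          ≈⟨ +-congˡ (-‿cong (trans (+-identityʳ _) (trans (*-congˡ (δ-refl oneBlock)) (*-identityʳ _)))) ⟩
        x oneBlock - x oneBlock  ≈⟨ -‿inverseʳ _ ⟩
        0#                       ≈⟨ sym (∂₀≈0 _ oneBlock) ⟩
        ∂ 0 (λ _ → 0#) oneBlock  ∎

-- Vertex 1 of the paper is zero : Fin n and
-- every block assignment starts with zero (1 ∈ B₁), so a partition is determined by its tail in Vec (Fin K) k.
module CompleteMinusTwo (j : ℕ) where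
  open import Data.Nat using (_+_; _≤_; _∸_)
  open import Data.Fin.Subset using (∣_∣)
  open ≡ using (refl; sym; trans; cong; cong₂; subst)
  open Occurrences
  open Patterns

  k n edgeSize : ℕ
  k        = 4 + j
  n        = suc k
  edgeSize = 3 + j

  H : Hypergraph n
  H = completeUniform n (n ∸ 2)

  Δ : ∀ {K} → Assign K n → Set
  Δ = InΔ H

  -- The block of vertex 1 contains 1 + a vertices.
  first-block-too-small : ∀ a b → a + b ≡ k → 3 ≤ b → ¬ edgeSize ≤ suc a
  first-block-too-small a b e 3≤b h = ℕₚ.<-irrefl (sym (trans (ℕₚ.+-comm b a) e)) (ℕₚ.+-mono-≤ 3≤b (ℕ.s≤s⁻¹ h))

  block-too-small : ∀ a b → a + b ≡ k → 2 ≤ a → ¬ edgeSize ≤ b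
  block-too-small a b e 2≤a h = ℕₚ.<-irrefl (sym e) (ℕₚ.+-mono-≤ 2≤a h)

  Δ-head : ∀ {K} (x : Fin (suc K)) t → Δ (x ∷ t) → x ≡ zero
  Δ-head zero    t _ = refl
  Δ-head (suc x) t (() , _)

  Δ-nonempty : ∀ {K} (σ : Assign K n) → Δ σ → ∀ v → 1 ≤ count v σ
  Δ-nonempty σ (_ , nonempty , _) v = lookup⇒count σ (proj₁ (nonempty v)) (proj₂ (nonempty v))

  Δ-edgeBlock : ∀ {K} (σ : Assign K n) → Δ σ → ∃ λ v → edgeSize ≤ count v σ
  Δ-edgeBlock σ (_ , _ , v , S , ∣S∣≡ , S⊆) =
    v , subst (_≤ count v σ) ∣S∣≡ (subst (∣ S ∣ ≤_) (∣block∣≡count σ v) (p⊆q⇒∣p∣≤∣q∣ S⊆))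

  edgeBlock : ∀ {K} (σ : Assign K n) v → count v σ ≡ edgeSize → SomeBlockHasEdge H σ
  edgeBlock σ v e = v , block σ v , trans (∣block∣≡count σ v) e , (λ i∈ → i∈)

  Δ₀-intro : ∀ (t : Vec (Fin 2) k) → 1 ≤ count 𝟙 t → SomeBlockHasEdge H (zero ∷ t) → Δ (zero ∷ t)
  Δ₀-intro t 1≤ edge = refl , nonempty , edge
    where
    nonempty : AllNonempty (zero ∷ t)
    nonempty zero = zero , refl
    nonempty 𝟙    = count⇒lookup (zero ∷ t) 𝟙 1≤

  Δ₁-intro : ∀ (t : Vec (Fin 3) k) → 1 ≤ count 𝟙 t → 1 ≤ count 𝟚 t → SomeBlockHasEdge H (zero ∷ t) → Δ (zero ∷ t)
  Δ₁-intro t 1≤₁ 1≤₂ edge = refl , nonempty , edge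
    where
    nonempty : AllNonempty (zero ∷ t)
    nonempty zero = zero , refl
    nonempty 𝟙    = count⇒lookup (zero ∷ t) 𝟙 1≤₁
    nonempty 𝟚    = count⇒lookup (zero ∷ t) 𝟚 1≤₂

  -- With b, p ranging over the vertices 2, …, n and "rest" the vertices not named:
  -- E = ({1}, rest), P b = (rest, {b}), F b = ({1, b}, rest), Q p = (rest, p) are the partitions in Δ₀;
  -- U b = ({1}, {b}, rest), U′ b = ({1}, rest, {b}), T p = (rest, {p₁}, {p₂}), T′ p = (rest, {p₂}, {p₁}),
  -- where p = {p₁ < p₂}, are the partitions in Δ₁.
  E : Assign 2 n
  E = zero ∷ replicate k 𝟙

  P F : Fin k → Assign 2 n
  P b = zero ∷ oneHot 𝟙 zero b
  F b = zero ∷ oneHot zero 𝟙 b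

  Q : Pair k → Assign 2 n
  Q p = zero ∷ twoHot 𝟙 𝟙 zero p

  U U′ : Fin k → Assign 3 n
  U  b = zero ∷ oneHot 𝟙 𝟚 b
  U′ b = zero ∷ oneHot 𝟚 𝟙 b

  T T′ : Pair k → Assign 3 n
  T  p = zero ∷ twoHot 𝟙 𝟚 zero p
  T′ p = zero ∷ twoHot 𝟚 𝟙 zero p

  count-E : count 𝟙 E ≡ k
  count-E = count-replicate k 𝟙

  count-P : ∀ b → count 𝟙 (P b) ≡ 1
  count-P b = count-oneHot-hot 𝟙 zero b (λ ())

  count-F : ∀ b → count 𝟙 (F b) ≡ edgeSize
  count-F b = count-oneHot-cold zero 𝟙 b (λ ())

  count-Q : ∀ p → count 𝟙 (Q p) ≡ 2
  count-Q p = count-twoHot-both 𝟙 zero p (λ ())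

  count₀-Q : ∀ p → count zero (Q p) ≡ edgeSize
  count₀-Q p = ℕₚ.suc-injective (count-twoHot-cold 𝟙 𝟙 zero p (λ ()) (λ ()))

  count₁-U : ∀ b → count 𝟙 (U b) ≡ 1
  count₁-U b = count-oneHot-hot 𝟙 𝟚 b (λ ())

  count₂-U : ∀ b → count 𝟚 (U b) ≡ edgeSize
  count₂-U b = count-oneHot-cold 𝟙 𝟚 b (λ ())

  count₁-U′ : ∀ b → count 𝟙 (U′ b) ≡ edgeSize
  count₁-U′ b = count-oneHot-cold 𝟚 𝟙 b (λ ())

  count₂-U′ : ∀ b → count 𝟚 (U′ b) ≡ 1
  count₂-U′ b = count-oneHot-hot 𝟚 𝟙 b (λ ())

  count₁-T : ∀ p → count 𝟙 (T p) ≡ 1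
  count₁-T p = count-twoHot-smaller 𝟙 𝟚 zero p (λ ()) (λ ())

  count₂-T : ∀ p → count 𝟚 (T p) ≡ 1
  count₂-T p = count-twoHot-larger 𝟙 𝟚 zero p (λ ()) (λ ())

  count₁-T′ : ∀ p → count 𝟙 (T′ p) ≡ 1
  count₁-T′ p = count-twoHot-larger 𝟚 𝟙 zero p (λ ()) (λ ())

  count₂-T′ : ∀ p → count 𝟚 (T′ p) ≡ 1
  count₂-T′ p = count-twoHot-smaller 𝟚 𝟙 zero p (λ ()) (λ ())

  count₀-T : ∀ p → count zero (T p) ≡ edgeSize
  count₀-T p = ℕₚ.suc-injective (count-twoHot-cold 𝟙 𝟚 zero p (λ ()) (λ ()))

  count₀-T′ : ∀ p → count zero (T′ p) ≡ edgeSize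
  count₀-T′ p = ℕₚ.suc-injective (count-twoHot-cold 𝟚 𝟙 zero p (λ ()) (λ ()))

  1≤-of-≡ : ∀ {a b} → a ≡ suc b → 1 ≤ a
  1≤-of-≡ refl = s≤s z≤n

  Δ-E : Δ E
  Δ-E = Δ₀-intro _ (1≤-of-≡ count-E)
          (𝟙 , block (F zero) 𝟙 , trans (∣block∣≡count (F zero) 𝟙) (count-F zero) , block-⊆ (F zero) E 𝟙 𝟙 F⊆E)
    where
    F⊆E : ∀ i → lookup (F zero) i ≡ 𝟙 → lookup E i ≡ 𝟙
    F⊆E (suc i) _ = Vecₚ.lookup-replicate i 𝟙

  Δ-P : ∀ b → Δ (P b)
  Δ-P b = Δ₀-intro _ (1≤-of-≡ (count-P b))
            (zero , block (F b) 𝟙 , trans (∣block∣≡count (F b) 𝟙) (count-F b) , block-⊆ (F b) (P b) 𝟙 zero F⊆P)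
    where
    F⊆P : ∀ i → lookup (F b) i ≡ 𝟙 → lookup (P b) i ≡ zero
    F⊆P (suc i) e with b Fin.≟ i
    ... | yes refl with trans (sym (lookup-oneHot-≡ zero 𝟙 b)) e
    ...   | ()
    F⊆P (suc i) e | no b≢i = lookup-oneHot-≢ 𝟙 zero b≢i

  Δ-F : ∀ b → Δ (F b)
  Δ-F b = Δ₀-intro _ (1≤-of-≡ (count-F b)) (edgeBlock (F b) 𝟙 (count-F b))

  Δ-Q : ∀ p → Δ (Q p)
  Δ-Q p = Δ₀-intro _ (1≤-of-≡ (count-Q p)) (edgeBlock (Q p) zero (count₀-Q p))

  Δ-U : ∀ b → Δ (U b)
  Δ-U b = Δ₁-intro _ (1≤-of-≡ (count₁-U b)) (1≤-of-≡ (count₂-U b)) (edgeBlock (U b) 𝟚 (count₂-U b))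

  Δ-U′ : ∀ b → Δ (U′ b)
  Δ-U′ b = Δ₁-intro _ (1≤-of-≡ (count₁-U′ b)) (1≤-of-≡ (count₂-U′ b)) (edgeBlock (U′ b) 𝟙 (count₁-U′ b))

  Δ-T : ∀ p → Δ (T p)
  Δ-T p = Δ₁-intro _ (1≤-of-≡ (count₁-T p)) (1≤-of-≡ (count₂-T p)) (edgeBlock (T p) zero (count₀-T p))

  Δ-T′ : ∀ p → Δ (T′ p)
  Δ-T′ p = Δ₁-intro _ (1≤-of-≡ (count₁-T′ p)) (1≤-of-≡ (count₂-T′ p)) (edgeBlock (T′ p) zero (count₀-T′ p))

  Δ-oneBlock : Δ (replicate {A = Fin 1} n zero)
  Δ-oneBlock = refl , (λ { zero → zero , refl }) ,
    (zero , block (F zero) 𝟙 , trans (∣block∣≡count (F zero) 𝟙) (count-F zero) ,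
     block-⊆ (F zero) (replicate n zero) 𝟙 zero (λ i _ → Vecₚ.lookup-replicate i zero))

  count-≢⇒≢ : ∀ {K} {β γ : Assign K n} v → count v β ≢ count v γ → β ≢ γ
  count-≢⇒≢ v counts≢ e = counts≢ (cong (count v) e)

  k≢edgeSize : k ≢ edgeSize
  k≢edgeSize e = ℕₚ.<-irrefl (sym e) (ℕₚ.n<1+n edgeSize)

  ≡edgeSize⇒≢1 : ∀ {a} → a ≡ edgeSize → a ≢ 1
  ≡edgeSize⇒≢1 refl ()

  E≢P : ∀ b → E ≢ P b
  E≢P b = count-≢⇒≢ 𝟙 (λ e → k≢1 (trans (sym count-E) (trans e (count-P b))))
    where k≢1 : k ≢ 1
          k≢1 ()

  E≢F : ∀ b → E ≢ F b
  E≢F b = count-≢⇒≢ 𝟙 (λ e → k≢edgeSize (trans (sym count-E) (trans e (count-F b))))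

  E≢Q : ∀ p → E ≢ Q p
  E≢Q p = count-≢⇒≢ 𝟙 (λ e → k≢2 (trans (sym count-E) (trans e (count-Q p))))
    where k≢2 : k ≢ 2
          k≢2 ()

  P≢F : ∀ b b′ → P b ≢ F b′
  P≢F b b′ = count-≢⇒≢ 𝟙 (λ e → ≡edgeSize⇒≢1 (count-F b′) (trans (sym e) (count-P b)))

  P≢Q : ∀ b p → P b ≢ Q p
  P≢Q b p = count-≢⇒≢ 𝟙 (λ e → 1≢2 (trans (sym (count-P b)) (trans e (count-Q p))))
    where 1≢2 : 1 ≢ 2
          1≢2 ()

  F≢Q : ∀ b p → F b ≢ Q p
  F≢Q b p = count-≢⇒≢ 𝟙 (λ e → edgeSize≢2 (trans (sym (count-F b)) (trans e (count-Q p))))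
    where edgeSize≢2 : edgeSize ≢ 2
          edgeSize≢2 ()

  U≢U′ : ∀ b b′ → U b ≢ U′ b′
  U≢U′ b b′ = count-≢⇒≢ 𝟙 (λ e → ≡edgeSize⇒≢1 (count₁-U′ b′) (sym (trans (sym (count₁-U b)) e)))

  U≢T : ∀ b p → U b ≢ T p
  U≢T b p = count-≢⇒≢ 𝟚 (λ e → ≡edgeSize⇒≢1 (count₂-U b) (trans e (count₂-T p)))

  U≢T′ : ∀ b p → U b ≢ T′ p
  U≢T′ b p = count-≢⇒≢ 𝟚 (λ e → ≡edgeSize⇒≢1 (count₂-U b) (trans e (count₂-T′ p)))

  U′≢T : ∀ b p → U′ b ≢ T p
  U′≢T b p = count-≢⇒≢ 𝟙 (λ e → ≡edgeSize⇒≢1 (count₁-U′ b) (trans e (count₁-T p)))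

  U′≢T′ : ∀ b p → U′ b ≢ T′ p
  U′≢T′ b p = count-≢⇒≢ 𝟙 (λ e → ≡edgeSize⇒≢1 (count₁-U′ b) (trans e (count₁-T′ p)))

  T≢T′ : ∀ p p′ → T p ≢ T′ p′
  T≢T′ p p′ e = twoHot≢twoHot-swapped p p′ (λ ()) (λ ()) (λ ()) (Vecₚ.∷-injectiveʳ e)

  P-injective : ∀ b b′ → P b ≡ P b′ → b ≡ b′
  P-injective b b′ e = oneHot-injective b b′ (λ ()) (Vecₚ.∷-injectiveʳ e)

  F-injective : ∀ b b′ → F b ≡ F b′ → b ≡ b′
  F-injective b b′ e = oneHot-injective b b′ (λ ()) (Vecₚ.∷-injectiveʳ e)

  Q-injective : ∀ p p′ → Q p ≡ Q p′ → p ≡ p′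
  Q-injective p p′ e = twoHot-injective p p′ (λ ()) (λ ()) (Vecₚ.∷-injectiveʳ e)

  U-injective : ∀ b b′ → U b ≡ U b′ → b ≡ b′
  U-injective b b′ e = oneHot-injective b b′ (λ ()) (Vecₚ.∷-injectiveʳ e)

  U′-injective : ∀ b b′ → U′ b ≡ U′ b′ → b ≡ b′
  U′-injective b b′ e = oneHot-injective b b′ (λ ()) (Vecₚ.∷-injectiveʳ e)

  T-injective : ∀ p p′ → T p ≡ T p′ → p ≡ p′
  T-injective p p′ e = twoHot-injective p p′ (λ ()) (λ ()) (Vecₚ.∷-injectiveʳ e)

  T′-injective : ∀ p p′ → T′ p ≡ T′ p′ → p ≡ p′
  T′-injective p p′ e = twoHot-injective p p′ (λ ()) (λ ()) (Vecₚ.∷-injectiveʳ e)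

  basis₀ : Fin n → Assign 2 n
  basis₀ zero    = E
  basis₀ (suc b) = P b

  Index₀ : Set
  Index₀ = Fin n ⊎ (Fin k ⊎ Pair k)

  point₀ : Index₀ → Assign 2 n
  point₀ = [ basis₀ , [ F , Q ]′ ]′

  basis₀-injective : ∀ c c′ → basis₀ c ≡ basis₀ c′ → c ≡ c′
  basis₀-injective zero    zero     e = refl
  basis₀-injective zero    (suc b′) e = ⊥-elim (E≢P b′ e)
  basis₀-injective (suc b) zero     e = ⊥-elim (E≢P b (sym e))
  basis₀-injective (suc b) (suc b′) e = cong suc (P-injective b b′ e)

  point₀-injective : ∀ i i′ → point₀ i ≡ point₀ i′ → i ≡ i′
  point₀-injective = ⊎-injective basis₀-injective (⊎-injective F-injective Q-injective F≢Q) basis₀≢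
    where
    basis₀≢ : ∀ c i → basis₀ c ≢ [ F , Q ]′ i
    basis₀≢ zero    (inj₁ b) = E≢F b
    basis₀≢ zero    (inj₂ p) = E≢Q p
    basis₀≢ (suc b) (inj₁ b′) = P≢F b b′
    basis₀≢ (suc b) (inj₂ p) = P≢Q b p

  Δ-basis₀ : ∀ c → Δ (basis₀ c)
  Δ-basis₀ zero    = Δ-E
  Δ-basis₀ (suc b) = Δ-P b

  Δ-point₀ : ∀ i → Δ (point₀ i)
  Δ-point₀ (inj₁ c)        = Δ-basis₀ c
  Δ-point₀ (inj₂ (inj₁ b)) = Δ-F b
  Δ-point₀ (inj₂ (inj₂ p)) = Δ-Q p

  lead partner : Pair n → Assign 3 n
  lead    = [ U , T ]′
  partner = [ U′ , T′ ]′

  Index₁ : Set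
  Index₁ = Pair n ⊎ Pair n

  point₁ : Index₁ → Assign 3 n
  point₁ = [ lead , partner ]′

  lead-injective : ∀ p p′ → lead p ≡ lead p′ → p ≡ p′
  lead-injective = ⊎-injective U-injective T-injective U≢T

  partner-injective : ∀ p p′ → partner p ≡ partner p′ → p ≡ p′
  partner-injective = ⊎-injective U′-injective T′-injective U′≢T′

  lead≢partner : ∀ p p′ → lead p ≢ partner p′
  lead≢partner (inj₁ b) (inj₁ b′) = U≢U′ b b′
  lead≢partner (inj₁ b) (inj₂ p′) = U≢T′ b p′
  lead≢partner (inj₂ p) (inj₁ b′) = λ e → U′≢T b′ p (sym e)
  lead≢partner (inj₂ p) (inj₂ p′) = T≢T′ p p′

  point₁-injective : ∀ i i′ → point₁ i ≡ point₁ i′ → i ≡ i′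
  point₁-injective = ⊎-injective lead-injective partner-injective lead≢partner

  Δ-point₁ : ∀ i → Δ (point₁ i)
  Δ-point₁ (inj₁ (inj₁ b)) = Δ-U b
  Δ-point₁ (inj₁ (inj₂ p)) = Δ-T p
  Δ-point₁ (inj₂ (inj₁ b)) = Δ-U′ b
  Δ-point₁ (inj₂ (inj₂ p)) = Δ-T′ p

  classify₀ : ∀ τ → (∃ λ i → point₀ i ≡ τ) ⊎ ¬ Δ τ
  classify₀ (x ∷ t) with x Fin.≟ zero
  ... | no x≢0   = inj₂ (λ τ∈Δ → x≢0 (Δ-head x t τ∈Δ))
  ... | yes refl = by-counts (count-total₂ t)
    where
    found : ∀ i {t′} → t ≡ t′ → zero ∷ t′ ≡ point₀ i → (∃ λ i → point₀ i ≡ zero ∷ t) ⊎ ¬ Δ (zero ∷ t)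
    found i refl e = inj₁ (i , sym e)
    by-counts : count zero t + count 𝟙 t ≡ k → (∃ λ i → point₀ i ≡ zero ∷ t) ⊎ ¬ Δ (zero ∷ t)
    by-counts s with count 𝟙 t in e₁
    ... | 0 = inj₂ (λ τ∈Δ → ℕₚ.<-irrefl (sym e₁) (Δ-nonempty (zero ∷ t) τ∈Δ 𝟙))
    ... | 1 with oneHot-of-count 𝟙 zero t (λ ()) e₁ (trans (cong (_+ count zero t) e₁) (trans (ℕₚ.+-comm 1 (count zero t)) s))
    ...   | b , eb = found (inj₁ (suc b)) eb refl
    by-counts s | 2 with twoHot-both-of-count 𝟙 zero t (λ ()) e₁ (trans (cong (_+ count zero t) e₁) (trans (ℕₚ.+-comm 2 (count zero t)) s))
    ...   | p , ep = found (inj₂ (inj₂ p)) ep refl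
    by-counts s | suc (suc (suc c)) with count zero t in e₀
    ...   | 0 = found (inj₁ zero) (replicate-of-count 𝟙 t (trans e₁ s)) refl
    ...   | 1 with oneHot-of-count zero 𝟙 t (λ ()) e₀ (trans (cong (_+ count 𝟙 t) e₀) (trans (cong (1 +_) e₁) s))
    ...     | b , eb = found (inj₂ (inj₁ b)) eb refl
    by-counts s | suc (suc (suc c)) | suc (suc d) = inj₂ (λ τ∈Δ → no-edge (Δ-edgeBlock (zero ∷ t) τ∈Δ))
      where
      no-edge : ¬ (∃ λ v → edgeSize ≤ count v (zero ∷ t))
      no-edge (zero , big) = first-block-too-small (2 + d) (3 + c) s (s≤s (s≤s (s≤s z≤n))) (subst (λ z → edgeSize ≤ suc z) e₀ big)
      no-edge (𝟙 , big)    = block-too-small (2 + d) (3 + c) s (s≤s (s≤s z≤n)) (subst (edgeSize ≤_) e₁ big)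

  -- The hypotheses say that each of the three blocks of zero ∷ t leaves at least three vertices outside.
  no-edgeBlock₁ : ∀ (t : Vec (Fin 3) k) → count zero t + count 𝟙 t + count 𝟚 t ≡ k → 3 ≤ count 𝟙 t + count 𝟚 t →
    (edgeSize ≤ count 𝟙 t → 2 ≤ count zero t + count 𝟚 t) → (edgeSize ≤ count 𝟚 t → 2 ≤ count zero t + count 𝟙 t) →
    ¬ Δ (zero ∷ t)
  no-edgeBlock₁ t s 3≤ 2≤₁ 2≤₂ σ∈Δ with Δ-edgeBlock (zero ∷ t) σ∈Δ
  ... | zero , big = first-block-too-small (count zero t) _ (trans (sym (ℕₚ.+-assoc (count zero t) _ _)) s) 3≤ big
  ... | 𝟙 , big = block-too-small _ (count 𝟙 t) (trans (sym (+-swap (count zero t) (count 𝟙 t) _)) s) (2≤₁ big) big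
    where +-swap : ∀ a b c → a + b + c ≡ (a + c) + b
          +-swap = solve-∀
  ... | 𝟚 , big = block-too-small _ (count 𝟚 t) s (2≤₂ big) big

  classify₁ : ∀ σ → (∃ λ i → point₁ i ≡ σ) ⊎ ¬ Δ σ
  classify₁ (x ∷ t) with x Fin.≟ zero
  ... | no x≢0   = inj₂ (λ σ∈Δ → x≢0 (Δ-head x t σ∈Δ))
  ... | yes refl = by-counts (count-total₃ t)
    where
    found : ∀ i {t′} → t ≡ t′ → zero ∷ t′ ≡ point₁ i → (∃ λ i → point₁ i ≡ zero ∷ t) ⊎ ¬ Δ (zero ∷ t)
    found i refl e = inj₁ (i , sym e)
    empty : ∀ (v : Fin 2) → count (suc v) t ≡ 0 → ¬ Δ (zero ∷ t)
    empty v e σ∈Δ = ℕₚ.<-irrefl (sym e) (Δ-nonempty (zero ∷ t) σ∈Δ (suc v))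
    single : ∀ {a} → a ≡ 1 → ¬ edgeSize ≤ a
    single refl (s≤s ())
    2≤2+ : ∀ a {b} → b ≡ suc a → 2 ≤ b + 1
    2≤2+ a refl = s≤s (ℕₚ.≤-trans (s≤s z≤n) (ℕₚ.≤-reflexive (sym (ℕₚ.+-comm a 1))))
    by-counts : count zero t + count 𝟙 t + count 𝟚 t ≡ k → (∃ λ i → point₁ i ≡ zero ∷ t) ⊎ ¬ Δ (zero ∷ t)
    by-counts s with count 𝟙 t in e₁ | count 𝟚 t in e₂
    ... | 0     | _ = inj₂ (empty zero e₁)
    ... | suc _ | 0 = inj₂ (empty 𝟙 e₂)
    ... | 1     | 1 with twoHot-of-count 𝟙 𝟚 zero t (λ ()) (λ ()) (λ ()) e₁ e₂
                           (trans (cong₂ (λ u w → u + w + count zero t) e₁ e₂) (trans (ℕₚ.+-comm 2 (count zero t)) (trans (sym (ℕₚ.+-assoc (count zero t) 1 1)) s)))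
    ...   | p , inj₁ ep = found (inj₁ (inj₂ p)) ep refl
    ...   | p , inj₂ ep = found (inj₂ (inj₂ p)) ep refl
    by-counts s | 1 | suc (suc c) with count zero t in e₀
    ...   | 0 with oneHot-of-count 𝟙 𝟚 t (λ ()) e₁ (trans (cong₂ _+_ e₁ e₂) s)
    ...     | b , eb = found (inj₁ (inj₁ b)) eb refl
    by-counts s | 1 | suc (suc c) | suc d =
      inj₂ (no-edgeBlock₁ t (trans (cong₂ _+_ (cong₂ _+_ e₀ e₁) e₂) s) (subst (3 ≤_) (sym (cong₂ _+_ e₁ e₂)) (s≤s (s≤s (s≤s z≤n))))
             (λ big → ⊥-elim (single e₁ big)) (λ _ → subst (2 ≤_) (sym (cong₂ _+_ e₀ e₁)) (2≤2+ d refl)))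
    by-counts s | suc (suc c) | 1 with count zero t in e₀
    ...   | 0 with oneHot-of-count 𝟚 𝟙 t (λ ()) e₂ (trans (cong₂ _+_ e₂ e₁) (trans (ℕₚ.+-comm 1 (suc (suc c))) s))
    ...     | b , eb = found (inj₂ (inj₁ b)) eb refl
    by-counts s | suc (suc c) | 1 | suc d =
      inj₂ (no-edgeBlock₁ t (trans (cong₂ _+_ (cong₂ _+_ e₀ e₁) e₂) s) (subst (3 ≤_) (sym (cong₂ _+_ e₁ e₂)) (s≤s (s≤s (ℕₚ.m≤n+m 1 c))))
             (λ _ → subst (2 ≤_) (sym (cong₂ _+_ e₀ e₂)) (2≤2+ d refl)) (λ big → ⊥-elim (single e₂ big)))
    by-counts s | suc (suc c) | suc (suc d) =
      inj₂ (no-edgeBlock₁ t (trans (cong₂ _+_ (cong (count zero t +_) e₁) e₂) s)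
             (subst (3 ≤_) (sym (cong₂ _+_ e₁ e₂)) (s≤s (s≤s (ℕₚ.≤-trans (s≤s z≤n) (ℕₚ.≤-reflexive (sym (ℕₚ.+-suc c (suc d))))))))
             (λ _ → subst (2 ≤_) (sym (cong (count zero t +_) e₂)) (ℕₚ.≤-trans (s≤s (s≤s z≤n)) (ℕₚ.m≤n+m _ (count zero t))))
             (λ _ → subst (2 ≤_) (sym (cong (count zero t +_) e₁)) (ℕₚ.≤-trans (s≤s (s≤s z≤n)) (ℕₚ.m≤n+m _ (count zero t)))))

  Δ₂-empty : ∀ (σ : Assign 4 n) → ¬ Δ σ
  Δ₂-empty (x ∷ t) σ∈Δ with Δ-head x t σ∈Δ
  ... | refl = no-edge (Δ-edgeBlock (zero ∷ t) σ∈Δ)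
    where
    nonempty : ∀ (v : Fin 3) → 1 ≤ count (suc v) t
    nonempty v = Δ-nonempty (zero ∷ t) σ∈Δ (suc v)
    c₀ = count zero t
    c₁ = count 𝟙 t
    c₂ = count 𝟚 t
    c₃ = count 𝟛 t
    total : c₀ + c₁ + c₂ + c₃ ≡ k
    total = count-total₄ t
    2≤ : ∀ {a b} → 1 ≤ a → 1 ≤ b → ∀ c → 2 ≤ a + b + c
    2≤ 1≤a 1≤b c = ℕₚ.≤-trans (ℕₚ.+-mono-≤ 1≤a 1≤b) (ℕₚ.m≤m+n _ c)
    no-edge : ¬ (∃ λ v → edgeSize ≤ count v (zero ∷ t))
    no-edge (zero , big) =
      first-block-too-small c₀ (c₁ + c₂ + c₃) (trans (r c₀ c₁ c₂ c₃) total)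
        (ℕₚ.+-mono-≤ (ℕₚ.+-mono-≤ (nonempty zero) (nonempty 𝟙)) (nonempty 𝟚)) big
      where r : ∀ a b c d → a + (b + c + d) ≡ a + b + c + d
            r = solve-∀
    no-edge (𝟙 , big) = block-too-small (c₂ + c₃ + c₀) c₁ (trans (r c₀ c₁ c₂ c₃) total) (2≤ (nonempty 𝟙) (nonempty 𝟚) c₀) big
      where r : ∀ a b c d → c + d + a + b ≡ a + b + c + d
            r = solve-∀
    no-edge (𝟚 , big) = block-too-small (c₁ + c₃ + c₀) c₂ (trans (r c₀ c₁ c₂ c₃) total) (2≤ (nonempty zero) (nonempty 𝟚) c₀) big
      where r : ∀ a b c d → b + d + a + c ≡ a + b + c + d
            r = solve-∀
    no-edge (𝟛 , big) = block-too-small (c₁ + c₂ + c₀) c₃ (trans (r c₀ c₁ c₂ c₃) total) (2≤ (nonempty zero) (nonempty 𝟙) c₀) big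
      where r : ∀ a b c d → b + c + a + d ≡ a + b + c + d
            r = solve-∀

  merge₀-T : ∀ p → merge₀ (T p) ≡ P (larger p)
  merge₀-T p = cong (zero ∷_) (trans (map-twoHot _ 𝟙 𝟚 zero p) (twoHot≡oneHot-larger 𝟙 zero p))

  merge₁-T : ∀ p → merge₁ (T p) ≡ Q p
  merge₁-T p = cong (zero ∷_) (map-twoHot _ 𝟙 𝟚 zero p)

  mergeLast-T : ∀ p → mergeLast (T p) ≡ P (smaller p)
  mergeLast-T p = cong (zero ∷_) (trans (map-twoHot _ 𝟙 𝟚 zero p) (twoHot≡oneHot-smaller 𝟙 zero p))

  merge₀-T′ : ∀ p → merge₀ (T′ p) ≡ P (smaller p)
  merge₀-T′ p = cong (zero ∷_) (trans (map-twoHot _ 𝟚 𝟙 zero p) (twoHot≡oneHot-smaller 𝟙 zero p))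

  merge₁-T′ : ∀ p → merge₁ (T′ p) ≡ Q p
  merge₁-T′ p = cong (zero ∷_) (map-twoHot _ 𝟚 𝟙 zero p)

  mergeLast-T′ : ∀ p → mergeLast (T′ p) ≡ P (larger p)
  mergeLast-T′ p = cong (zero ∷_) (trans (map-twoHot _ 𝟚 𝟙 zero p) (twoHot≡oneHot-larger 𝟙 zero p))

  merge₀-U : ∀ b → merge₀ (U b) ≡ F b
  merge₀-U b = cong (zero ∷_) (map-oneHot _ 𝟙 𝟚 b)

  merge₁-U : ∀ b → merge₁ (U b) ≡ E
  merge₁-U b = cong (zero ∷_) (trans (map-oneHot _ 𝟙 𝟚 b) (oneHot-same 𝟙 b))

  mergeLast-U : ∀ b → mergeLast (U b) ≡ P b
  mergeLast-U b = cong (zero ∷_) (map-oneHot _ 𝟙 𝟚 b)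

  merge₀-U′ : ∀ b → merge₀ (U′ b) ≡ P b
  merge₀-U′ b = cong (zero ∷_) (map-oneHot _ 𝟚 𝟙 b)

  merge₁-U′ : ∀ b → merge₁ (U′ b) ≡ E
  merge₁-U′ b = cong (zero ∷_) (trans (map-oneHot _ 𝟚 𝟙 b) (oneHot-same 𝟙 b))

  mergeLast-U′ : ∀ b → mergeLast (U′ b) ≡ F b
  mergeLast-U′ b = cong (zero ∷_) (map-oneHot _ 𝟚 𝟙 b)

module Homology {c ℓ} (𝔽 : Field c ℓ) (j : ℕ) where
  open Field 𝔽 hiding (zero)
  open ListSums commutativeRing
  open CompleteMinusTwo j
  open Occurrences using (count)
  open Patterns using (oneHot; lookup-oneHot-≡; lookup-oneHot-≢)
  open Complex 𝔽 H
  open ChainComplex 𝔽 H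
  open PairCount using (toPair; fromPair; toPair-fromPair; fromPair-toPair)
  open import Algebra.Properties.Ring ring using (-‿involutive; -‿distribˡ-*; -‿distribʳ-*; -0#≈0#)
  open import Algebra.Properties.AbelianGroup +-abelianGroup using (⁻¹-∙-comm)
  open import Algebra.Properties.Group +-group using (inverseʳ-unique; x≈y⇒x∙y⁻¹≈ε)
  open import Relation.Binary.Reasoning.Setoid setoid

  almostCommutativeRing : AlmostCommutativeRing c ℓ
  almostCommutativeRing = fromCommutativeRing commutativeRing (λ _ → nothing)

  a-0≈a : ∀ {a b} → b ≈ 0# → a - b ≈ a
  a-0≈a b≈0 = trans (+-congˡ (trans (-‿cong b≈0) -0#≈0#)) (+-identityʳ _)

  x≈y+z⇒x-z≈y : ∀ {x y z} → x ≈ y + z → x - z ≈ y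
  x≈y+z⇒x-z≈y {x} {y} {z} x≈y+z = begin
    x - z          ≈⟨ +-congʳ x≈y+z ⟩
    (y + z) - z    ≈⟨ +-assoc y z (- z) ⟩
    y + (z - z)    ≈⟨ +-congˡ (-‿inverseʳ z) ⟩
    y + 0#         ≈⟨ +-identityʳ y ⟩
    y              ∎

  swap-ends : ∀ a b d → (a - b) + d ≈ (d - b) + a
  swap-ends a b d = trans (+-assoc a (- b) d) (trans (+-comm a _) (+-congʳ (+-comm (- b) d)))

  0-0≈0 : ∀ {a b} → a ≈ 0# → b ≈ 0# → a - b ≈ 0#
  0-0≈0 a≈0 b≈0 = trans (a-0≈a b≈0) a≈0

  indices₀ : List Index₀
  indices₀ = List.map inj₁ (allFin n) ++ List.map inj₂ (List.map inj₁ (allFin k) ++ List.map inj₂ (allPair k))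

  sifting₀ : Sifting (⊎.≡-dec Fin._≟_ (⊎.≡-dec Fin._≟_ _≟ᴾ_)) indices₀
  sifting₀ = sifting-⊎ (sifting-allFin n) (sifting-⊎ (sifting-allFin k) (sifting-allPair k))

  indices₁ : List Index₁
  indices₁ = List.map inj₁ (allPair n) ++ List.map inj₂ (allPair n)

  sifting₁ : Sifting (⊎.≡-dec _≟ᴾ_ _≟ᴾ_) indices₁
  sifting₁ = sifting-⊎ (sifting-allPair n) (sifting-allPair n)

  expansion₀ : ∀ x → Supported x → ∀ τ → x τ ≈ ∑ indices₀ (λ i → x (point₀ i) * δ (point₀ i) τ)
  expansion₀ = supported-expansion sifting₀ point₀ point₀-injective Δ-point₀ classify₀

  expansion₁ : ∀ x → Supported x → ∀ σ → x σ ≈ ∑ indices₁ (λ i → x (point₁ i) * δ (point₁ i) σ)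
  expansion₁ = supported-expansion sifting₁ point₁ point₁-injective Δ-point₁ classify₁

  ∑-indices₁ : ∀ (f : Index₁ → Carrier) → ∑ indices₁ f ≈
    (∑ (allFin k) (λ b → f (inj₁ (inj₁ b))) + ∑ (allPair k) (λ p → f (inj₁ (inj₂ p))))
    + (∑ (allFin k) (λ b → f (inj₂ (inj₁ b))) + ∑ (allPair k) (λ p → f (inj₂ (inj₂ p))))
  ∑-indices₁ f = trans (∑-inj₁-inj₂ (allPair n) (allPair n) f)
                       (+-cong (∑-inj₁-inj₂ (allFin k) (allPair k) _) (∑-inj₁-inj₂ (allFin k) (allPair k) _))

  incidence-U : ∀ b τ → incidence 1 (U b) τ ≈ (δ (F b) τ - δ E τ) + δ (P b) τ
  incidence-U b = incidence-faces (U b) (merge₀-U b) (merge₁-U b) (mergeLast-U b)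

  incidence-U′ : ∀ b τ → incidence 1 (U′ b) τ ≈ (δ (P b) τ - δ E τ) + δ (F b) τ
  incidence-U′ b = incidence-faces (U′ b) (merge₀-U′ b) (merge₁-U′ b) (mergeLast-U′ b)

  incidence-T : ∀ p τ → incidence 1 (T p) τ ≈ (δ (P (larger p)) τ - δ (Q p) τ) + δ (P (smaller p)) τ
  incidence-T p = incidence-faces (T p) (merge₀-T p) (merge₁-T p) (mergeLast-T p)

  incidence-T′ : ∀ p τ → incidence 1 (T′ p) τ ≈ (δ (P (smaller p)) τ - δ (Q p) τ) + δ (P (larger p)) τ
  incidence-T′ p = incidence-faces (T′ p) (merge₀-T′ p) (merge₁-T′ p) (mergeLast-T′ p)

  -- A lead and its partner have the same faces, with the first and the last one exchanged.
  incidence-lead≈partner : ∀ p τ → incidence 1 (lead p) τ ≈ incidence 1 (partner p) τ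
  incidence-lead≈partner (inj₁ b) τ = trans (incidence-U b τ) (trans (swap-ends _ _ _) (sym (incidence-U′ b τ)))
  incidence-lead≈partner (inj₂ p) τ = trans (incidence-T p τ) (trans (swap-ends _ _ _) (sym (incidence-T′ p τ)))

  -- Homology in degree 1

  cycle₁ : Pair n → Chain 2
  cycle₁ p σ = δ (lead p) σ - δ (partner p) σ

  cycle₁-supported : ∀ p → Supported (cycle₁ p)
  cycle₁-supported p σ σ∉Δ =
    0-0≈0 (δ-supported (lead p) (Δ-point₁ (inj₁ p)) σ σ∉Δ) (δ-supported (partner p) (Δ-point₁ (inj₂ p)) σ σ∉Δ)

  cycle₁-isCycle : ∀ p → IsCycle 2 (cycle₁ p)
  cycle₁-isCycle p τ = trans (∂-δ-δ 1 (lead p) (partner p) τ) (x≈y⇒x∙y⁻¹≈ε (incidence-lead≈partner p τ))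

  cycle₁-at-lead : ∀ p p₀ → cycle₁ p (lead p₀) ≈ select (p₀ ≟ᴾ p) 1#
  cycle₁-at-lead p p₀ = trans (a-0≈a (δ-≢ (λ e → lead≢partner p₀ p (≡.sym e)))) (δ-injective _≟ᴾ_ lead lead-injective p p₀)

  basis₁ : Fin (n C 2) → Chain 2
  basis₁ i = cycle₁ (toPair n i)

  lin-basis₁ : ∀ a τ → lin basis₁ a τ ≈ ∑ (allPair n) (λ p → a (fromPair n p) * cycle₁ p τ)
  lin-basis₁ a τ =
    trans (∑-cong (allFin (n C 2)) (λ i → reflexive (≡.cong (λ i′ → a i′ * basis₁ i τ) (≡.sym (fromPair-toPair n i)))))
          (∑-toPair n (λ p → a (fromPair n p) * cycle₁ p τ))

  ∂-expansion₁ : ∀ x → Supported x → ∀ τ → ∂ 1 x τ ≈ ∑ indices₁ (λ i → x (point₁ i) * incidence 1 (point₁ i) τ)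
  ∂-expansion₁ x x-supp = ∂-∑δ 1 indices₁ (λ i → x (point₁ i)) point₁ x (expansion₁ x x-supp)

  incidence-U-at-F : ∀ b q → incidence 1 (U b) (F q) ≈ δ (F b) (F q)
  incidence-U-at-F b q = trans (incidence-U b (F q)) (trans (+-congˡ (δ-≢ (P≢F b q))) (trans (+-identityʳ _) (a-0≈a (δ-≢ (E≢F q)))))

  incidence-U′-at-F : ∀ b q → incidence 1 (U′ b) (F q) ≈ δ (F b) (F q)
  incidence-U′-at-F b q = trans (incidence-U′ b (F q)) (trans (+-congʳ (0-0≈0 (δ-≢ (P≢F b q)) (δ-≢ (E≢F q)))) (+-identityˡ _))

  incidence-T-at-F : ∀ p q → incidence 1 (T p) (F q) ≈ 0#
  incidence-T-at-F p q = trans (incidence-T p (F q))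
    (trans (+-cong (0-0≈0 (δ-≢ (P≢F (larger p) q)) (δ-≢ (λ e → F≢Q q p (≡.sym e)))) (δ-≢ (P≢F (smaller p) q))) (+-identityʳ 0#))

  incidence-T′-at-F : ∀ p q → incidence 1 (T′ p) (F q) ≈ 0#
  incidence-T′-at-F p q = trans (incidence-T′ p (F q))
    (trans (+-cong (0-0≈0 (δ-≢ (P≢F (smaller p) q)) (δ-≢ (λ e → F≢Q q p (≡.sym e)))) (δ-≢ (P≢F (larger p) q))) (+-identityʳ 0#))

  incidence-U-at-Q : ∀ b p → incidence 1 (U b) (Q p) ≈ 0#
  incidence-U-at-Q b p = trans (incidence-U b (Q p)) (trans (+-cong (0-0≈0 (δ-≢ (F≢Q b p)) (δ-≢ (E≢Q p))) (δ-≢ (P≢Q b p))) (+-identityʳ 0#))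

  incidence-U′-at-Q : ∀ b p → incidence 1 (U′ b) (Q p) ≈ 0#
  incidence-U′-at-Q b p = trans (incidence-U′ b (Q p)) (trans (+-cong (0-0≈0 (δ-≢ (P≢Q b p)) (δ-≢ (E≢Q p))) (δ-≢ (F≢Q b p))) (+-identityʳ 0#))

  incidence-T-at-Q : ∀ p p₀ → incidence 1 (T p) (Q p₀) ≈ - δ (Q p) (Q p₀)
  incidence-T-at-Q p p₀ = trans (incidence-T p (Q p₀))
    (trans (+-cong (+-congʳ (δ-≢ (P≢Q (larger p) p₀))) (δ-≢ (P≢Q (smaller p) p₀))) (trans (+-identityʳ _) (+-identityˡ _)))

  incidence-T′-at-Q : ∀ p p₀ → incidence 1 (T′ p) (Q p₀) ≈ - δ (Q p) (Q p₀)
  incidence-T′-at-Q p p₀ = trans (incidence-T′ p (Q p₀))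
    (trans (+-cong (+-congʳ (δ-≢ (P≢Q (smaller p) p₀))) (δ-≢ (P≢Q (larger p) p₀))) (trans (+-identityʳ _) (+-identityˡ _)))

  ∂-at-F : ∀ x → Supported x → ∀ q → ∂ 1 x (F q) ≈ x (U q) + x (U′ q)
  ∂-at-F x x-supp q =
    trans (∂-expansion₁ x x-supp (F q)) (trans (∑-indices₁ _)
      (+-cong (trans (+-cong (on-U U incidence-U-at-F) (on-T T incidence-T-at-F)) (+-identityʳ _))
              (trans (+-cong (on-U U′ incidence-U′-at-F) (on-T T′ incidence-T′-at-F)) (+-identityʳ _))))
    where
    on-U : ∀ V → (∀ b q → incidence 1 (V b) (F q) ≈ δ (F b) (F q)) →
      ∑ (allFin k) (λ b → x (V b) * incidence 1 (V b) (F q)) ≈ x (V q)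
    on-U V at-F = trans (∑-cong (allFin k) (λ b → *-congˡ (at-F b q))) (∑-δ-sifting (sifting-allFin k) (λ b → x (V b)) F F-injective q)
    on-T : ∀ W → (∀ p q → incidence 1 (W p) (F q) ≈ 0#) → ∑ (allPair k) (λ p → x (W p) * incidence 1 (W p) (F q)) ≈ 0#
    on-T W at-F = ∑-zero (allPair k) (λ p → trans (*-congˡ (at-F p q)) (zeroʳ _))

  ∂-at-Q : ∀ x → Supported x → ∀ p₀ → ∂ 1 x (Q p₀) ≈ - x (T p₀) + - x (T′ p₀)
  ∂-at-Q x x-supp p₀ =
    trans (∂-expansion₁ x x-supp (Q p₀)) (trans (∑-indices₁ _)
      (+-cong (trans (+-cong (on-U U incidence-U-at-Q) (on-T T incidence-T-at-Q)) (+-identityˡ _))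
              (trans (+-cong (on-U U′ incidence-U′-at-Q) (on-T T′ incidence-T′-at-Q)) (+-identityˡ _))))
    where
    on-U : ∀ V → (∀ b p → incidence 1 (V b) (Q p) ≈ 0#) → ∑ (allFin k) (λ b → x (V b) * incidence 1 (V b) (Q p₀)) ≈ 0#
    on-U V at-Q = ∑-zero (allFin k) (λ b → trans (*-congˡ (at-Q b p₀)) (zeroʳ _))
    on-T : ∀ W → (∀ p p₀ → incidence 1 (W p) (Q p₀) ≈ - δ (Q p) (Q p₀)) →
      ∑ (allPair k) (λ p → x (W p) * incidence 1 (W p) (Q p₀)) ≈ - x (W p₀)
    on-T W at-Q = begin
      ∑ (allPair k) (λ p → x (W p) * incidence 1 (W p) (Q p₀))
        ≈⟨ ∑-cong (allPair k) (λ p → trans (*-congˡ (at-Q p p₀)) (sym (-‿distribʳ-* _ _))) ⟩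
      ∑ (allPair k) (λ p → - (x (W p) * δ (Q p) (Q p₀)))   ≈⟨ ∑-neg (allPair k) _ ⟩
      - ∑ (allPair k) (λ p → x (W p) * δ (Q p) (Q p₀))     ≈⟨ -‿cong (∑-δ-sifting (sifting-allPair k) (λ p → x (W p)) Q Q-injective p₀) ⟩
      - x (W p₀) ∎

  partner-coefficient : ∀ x → Supported x → IsCycle 2 x → ∀ p → x (partner p) ≈ - x (lead p)
  partner-coefficient x x-supp x-cycle (inj₁ q)  = inverseʳ-unique _ _ (trans (sym (∂-at-F x x-supp q)) (x-cycle (F q)))
  partner-coefficient x x-supp x-cycle (inj₂ p₀) = inverseʳ-unique _ _ (begin
    x (T p₀) + x (T′ p₀)          ≈⟨ sym (-‿involutive _) ⟩
    - - (x (T p₀) + x (T′ p₀))    ≈⟨ -‿cong (sym (⁻¹-∙-comm _ _)) ⟩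
    - (- x (T p₀) + - x (T′ p₀))  ≈⟨ -‿cong (trans (sym (∂-at-Q x x-supp p₀)) (x-cycle (Q p₀))) ⟩
    - 0#                          ≈⟨ -0#≈0# ⟩
    0#                            ∎)

  cycles₁-span : ∀ x → Supported x → IsCycle 2 x → ∀ τ → x τ ≈ lin basis₁ (λ i → x (lead (toPair n i))) τ
  cycles₁-span x x-supp x-cycle τ = begin
    x τ
      ≈⟨ expansion₁ x x-supp τ ⟩
    ∑ indices₁ (λ i → x (point₁ i) * δ (point₁ i) τ)
      ≈⟨ ∑-inj₁-inj₂ (allPair n) (allPair n) _ ⟩
    ∑ (allPair n) (λ p → x (lead p) * δ (lead p) τ) + ∑ (allPair n) (λ p → x (partner p) * δ (partner p) τ)
      ≈⟨ sym (∑-+ (allPair n) _ _) ⟩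
    ∑ (allPair n) (λ p → x (lead p) * δ (lead p) τ + x (partner p) * δ (partner p) τ)
      ≈⟨ ∑-cong (allPair n) lead-and-partner ⟩
    ∑ (allPair n) (λ p → x (lead (toPair n (fromPair n p))) * cycle₁ p τ)
      ≈⟨ sym (lin-basis₁ (λ i → x (lead (toPair n i))) τ) ⟩
    lin basis₁ (λ i → x (lead (toPair n i))) τ ∎
    where
    lead-and-partner : ∀ p → x (lead p) * δ (lead p) τ + x (partner p) * δ (partner p) τ
                             ≈ x (lead (toPair n (fromPair n p))) * cycle₁ p τ
    lead-and-partner p = begin
      x (lead p) * δ (lead p) τ + x (partner p) * δ (partner p) τ
        ≈⟨ +-congˡ (*-congʳ (partner-coefficient x x-supp x-cycle p)) ⟩
      x (lead p) * δ (lead p) τ + - x (lead p) * δ (partner p) τ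
        ≈⟨ +-congˡ (trans (sym (-‿distribˡ-* _ _)) (-‿distribʳ-* _ _)) ⟩
      x (lead p) * δ (lead p) τ + x (lead p) * - δ (partner p) τ
        ≈⟨ sym (distribˡ _ _ _) ⟩
      x (lead p) * cycle₁ p τ
        ≡⟨ ≡.cong (λ p′ → x (lead p′) * cycle₁ p τ) (≡.sym (toPair-fromPair n p)) ⟩
      x (lead (toPair n (fromPair n p))) * cycle₁ p τ ∎

  cycles₁-independent : ∀ a → IsBoundary 2 (lin basis₁ a) → ∀ i → a i ≈ 0#
  cycles₁-independent a (w , w-supp , lin≈∂w) i = begin
    a i                                                      ≡⟨ ≡.cong a (≡.sym (fromPair-toPair n i)) ⟩
    a (fromPair n p₀)                                        ≈⟨ sym (sifting-allPair n .sift p₀ (λ p → a (fromPair n p))) ⟩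
    ∑ (allPair n) (λ p → select (p₀ ≟ᴾ p) (a (fromPair n p)))
      ≈⟨ ∑-cong (allPair n) (λ p → trans (select-* (p₀ ≟ᴾ p) _) (*-congˡ (sym (cycle₁-at-lead p p₀)))) ⟩
    ∑ (allPair n) (λ p → a (fromPair n p) * cycle₁ p (lead p₀))  ≈⟨ sym (lin-basis₁ a (lead p₀)) ⟩
    lin basis₁ a (lead p₀)                                   ≈⟨ lin≈∂w (lead p₀) ⟩
    ∂ 2 w (lead p₀)                                          ≈⟨ ∂-zero 2 (λ σ → w-supp σ (Δ₂-empty σ)) (lead p₀) ⟩
    0#                                                       ∎
    where p₀ = toPair n i

  dimHC₁ : HomologyDim 2 (n C 2)
  dimHC₁ = basis₁ , (λ i → cycle₁-supported (toPair n i) , cycle₁-isCycle (toPair n i)) , cycles₁-independent ,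
    λ x x-supp x-cycle → (λ i → x (lead (toPair n i))) , (λ _ → 0#) , (λ _ _ → refl) ,
      λ τ → trans (x≈y⇒x∙y⁻¹≈ε (cycles₁-span x x-supp x-cycle τ)) (sym (∂-zero 2 (λ _ → refl) τ))

  -- Homology in degree 0

  vertex : Fin (n C 1) → Fin n
  vertex = ≡.subst Fin (nC1≡n n)

  cycle₀ : Fin (n C 1) → Chain 1
  cycle₀ i = δ (basis₀ (vertex i))

  lin-cycle₀ : ∀ a τ → lin cycle₀ a τ ≈ ∑ (allFin n) (λ c → a (≡.subst Fin (≡.sym (nC1≡n n)) c) * δ (basis₀ c) τ)
  lin-cycle₀ a τ =
    trans (∑-cong (allFin (n C 1)) (λ i → reflexive (≡.cong (λ i′ → a i′ * cycle₀ i τ) (≡.sym (subst-sym-subst (nC1≡n n) i)))))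
          (∑-allFin-subst (nC1≡n n) (λ c → a (≡.subst Fin (≡.sym (nC1≡n n)) c) * δ (basis₀ c) τ))

  ⟪cocycle,∂⟫≈0 : ∀ g → (∀ i → coboundary 1 g (point₁ i) ≈ 0#) → ∀ w → Supported w → ⟪ g , ∂ 1 w ⟫ ≈ 0#
  ⟪cocycle,∂⟫≈0 g g-cocycle w w-supp = trans (⟪⟫-∂ 1 g w) (∑-zero (allAssign 3 n) term)
    where
    term : ∀ σ → w σ * coboundary 1 g σ ≈ 0#
    term σ with classify₁ σ
    ... | inj₁ (i , ≡.refl) = trans (*-congˡ (g-cocycle i)) (zeroʳ _)
    ... | inj₂ σ∉Δ          = trans (*-congʳ (w-supp σ σ∉Δ)) (zeroˡ _)

  -- This separates E from the P b modulo boundaries.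
  secondBlockHasEdge : Assign 2 n → Carrier
  secondBlockHasEdge τ = select (edgeSize ℕ.≤? count 𝟙 τ) 1#

  secondBlockHasEdge-E : secondBlockHasEdge E ≈ 1#
  secondBlockHasEdge-E = select-yes (edgeSize ℕ.≤? count 𝟙 E) (≡.subst (edgeSize ℕ.≤_) (≡.sym count-E) (ℕₚ.n≤1+n edgeSize)) 1#

  secondBlockHasEdge-F : ∀ b → secondBlockHasEdge (F b) ≈ 1#
  secondBlockHasEdge-F b = select-yes (edgeSize ℕ.≤? count 𝟙 (F b)) (ℕₚ.≤-reflexive (≡.sym (count-F b))) 1#

  secondBlockHasEdge-P : ∀ b → secondBlockHasEdge (P b) ≈ 0#
  secondBlockHasEdge-P b = select-no (edgeSize ℕ.≤? count 𝟙 (P b)) (λ big → ≤1 (≡.subst (edgeSize ℕ.≤_) (count-P b) big)) 1#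
    where ≤1 : ¬ edgeSize ℕ.≤ 1
          ≤1 (s≤s ())

  secondBlockHasEdge-Q : ∀ p → secondBlockHasEdge (Q p) ≈ 0#
  secondBlockHasEdge-Q p = select-no (edgeSize ℕ.≤? count 𝟙 (Q p)) (λ big → ≤2 (≡.subst (edgeSize ℕ.≤_) (count-Q p) big)) 1#
    where ≤2 : ¬ edgeSize ℕ.≤ 2
          ≤2 (s≤s (s≤s ()))

  secondBlockHasEdge-cocycle : ∀ i → coboundary 1 secondBlockHasEdge (point₁ i) ≈ 0#
  secondBlockHasEdge-cocycle (inj₁ (inj₁ b)) =
    trans (coboundary-faces secondBlockHasEdge (U b) (merge₀-U b) (merge₁-U b) (mergeLast-U b))
          (trans (+-cong (x≈y⇒x∙y⁻¹≈ε (trans (secondBlockHasEdge-F b) (sym secondBlockHasEdge-E))) (secondBlockHasEdge-P b)) (+-identityʳ 0#))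
  secondBlockHasEdge-cocycle (inj₁ (inj₂ p)) =
    trans (coboundary-faces secondBlockHasEdge (T p) (merge₀-T p) (merge₁-T p) (mergeLast-T p))
          (trans (+-cong (0-0≈0 (secondBlockHasEdge-P (larger p)) (secondBlockHasEdge-Q p)) (secondBlockHasEdge-P (smaller p))) (+-identityʳ 0#))
  secondBlockHasEdge-cocycle (inj₂ (inj₁ b)) =
    trans (coboundary-faces secondBlockHasEdge (U′ b) (merge₀-U′ b) (merge₁-U′ b) (mergeLast-U′ b))
          (trans (+-cong (+-cong (secondBlockHasEdge-P b) (-‿cong secondBlockHasEdge-E)) (secondBlockHasEdge-F b)) (trans (+-congʳ (+-identityˡ _)) (-‿inverseˡ 1#)))
  secondBlockHasEdge-cocycle (inj₂ (inj₂ p)) =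
    trans (coboundary-faces secondBlockHasEdge (T′ p) (merge₀-T′ p) (merge₁-T′ p) (mergeLast-T′ p))
          (trans (+-cong (0-0≈0 (secondBlockHasEdge-P (smaller p)) (secondBlockHasEdge-Q p)) (secondBlockHasEdge-P (larger p))) (+-identityʳ 0#))

  inSecondBlock-E : ∀ b → inSecondBlock (suc b) E ≈ 1#
  inSecondBlock-E b = select-yes (lookup E (suc b) Fin.≟ 𝟙) (Vecₚ.lookup-replicate b 𝟙) 1#

  inSecondBlock-P : ∀ b b′ → inSecondBlock (suc b) (P b′) ≈ select (b Fin.≟ b′) 1#
  inSecondBlock-P b b′ = select-iff (lookup (P b′) (suc b) Fin.≟ 𝟙) (b Fin.≟ b′) b≡b′ (λ { ≡.refl → lookup-oneHot-≡ 𝟙 zero b }) 1#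
    where
    b≡b′ : lookup (oneHot 𝟙 zero b′) b ≡ 𝟙 → b ≡ b′
    b≡b′ e with b′ Fin.≟ b
    ... | yes b′≡b = ≡.sym b′≡b
    ... | no b′≢b with ≡.trans (≡.sym (lookup-oneHot-≢ 𝟙 zero b′≢b)) e
    ...   | ()

  cycles₀-independent : ∀ a → IsBoundary 1 (lin cycle₀ a) → ∀ i → a i ≈ 0#
  cycles₀-independent a (w , w-supp , lin≈∂w) i =
    trans (reflexive (≡.cong a (≡.sym (subst-sym-subst (nC1≡n n) i)))) (a′≈0 (vertex i))
    where
    a′ : Fin n → Carrier
    a′ c = a (≡.subst Fin (≡.sym (nC1≡n n)) c)
    vanishes : ∀ g → (∀ i → coboundary 1 g (point₁ i) ≈ 0#) → a′ zero * g E + ∑ (allFin k) (λ b → a′ (suc b) * g (P b)) ≈ 0#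
    vanishes g g-cocycle = begin
      a′ zero * g E + ∑ (allFin k) (λ b → a′ (suc b) * g (P b))  ≈⟨ sym (∑-allFin-suc k _) ⟩
      ∑ (allFin n) (λ c → a′ c * g (basis₀ c))                   ≈⟨ sym (⟪⟫-∑δ g (allFin n) a′ basis₀) ⟩
      ⟪ g , (λ τ → ∑ (allFin n) (λ c → a′ c * δ (basis₀ c) τ)) ⟫
        ≈⟨ ∑-cong (allAssign 2 n) (λ τ → *-congˡ (trans (sym (lin-cycle₀ a τ)) (lin≈∂w τ))) ⟩
      ⟪ g , ∂ 1 w ⟫                                               ≈⟨ ⟪cocycle,∂⟫≈0 g g-cocycle w w-supp ⟩
      0#                                                          ∎
    a′₀≈0 : a′ zero ≈ 0#
    a′₀≈0 = begin
      a′ zero                                                         ≈⟨ sym (*-identityʳ _) ⟩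
      a′ zero * 1#                                                    ≈⟨ *-congˡ (sym secondBlockHasEdge-E) ⟩
      a′ zero * secondBlockHasEdge E                                            ≈⟨ sym (+-identityʳ _) ⟩
      a′ zero * secondBlockHasEdge E + 0#
        ≈⟨ +-congˡ (sym (∑-zero (allFin k) (λ b → trans (*-congˡ (secondBlockHasEdge-P b)) (zeroʳ _)))) ⟩
      a′ zero * secondBlockHasEdge E + ∑ (allFin k) (λ b → a′ (suc b) * secondBlockHasEdge (P b))  ≈⟨ vanishes secondBlockHasEdge secondBlockHasEdge-cocycle ⟩
      0#                                                              ∎
    a′≈0 : ∀ c → a′ c ≈ 0#
    a′≈0 zero    = a′₀≈0
    a′≈0 (suc b) = trans (inverseʳ-unique _ _ (begin
      a′ zero + a′ (suc b)
        ≈⟨ +-cong (sym (trans (*-congˡ (inSecondBlock-E b)) (*-identityʳ _)))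
                  (sym (trans (∑-cong (allFin k) (λ b′ → trans (*-congˡ (inSecondBlock-P b b′)) (sym (select-* (b Fin.≟ b′) _))))
                              (sifting-allFin k .sift b (λ b′ → a′ (suc b′))))) ⟩
      a′ zero * inSecondBlock (suc b) E + ∑ (allFin k) (λ b′ → a′ (suc b′) * inSecondBlock (suc b) (P b′))
        ≈⟨ vanishes (inSecondBlock (suc b)) (λ i → coboundary-inSecondBlock (suc b) (point₁ i)) ⟩
      0# ∎)) (trans (-‿cong a′₀≈0) -0#≈0#)

  -- Modulo the boundaries ∂ (U b) = F b − E + P b and ∂ (T p) = P p₂ − Q p + P p₁, every F b and every Q p is a
  -- combination of E and the P b; the filler w records the boundaries used.
  module Spanning₀ (x : Chain 1) (x-supp : Supported x) where

    pairsAt : Fin k → Carrier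
    pairsAt b = ∑ (allPair k) (λ p → x (Q p) * select (larger p Fin.≟ b) 1#)
              + ∑ (allPair k) (λ p → x (Q p) * select (smaller p Fin.≟ b) 1#)

    coefficient : Fin n → Carrier
    coefficient zero    = x E + ∑ (allFin k) (λ b → x (F b))
    coefficient (suc b) = (x (P b) - x (F b)) + pairsAt b

    a : Fin (n C 1) → Carrier
    a i = coefficient (vertex i)

    Filler : Set
    Filler = Pair k ⊎ Fin k

    fillers : List Filler
    fillers = List.map inj₁ (allPair k) ++ List.map inj₂ (allFin k)

    fillerPoint : Filler → Assign 3 n
    fillerPoint = [ T , U ]′

    fillerCoefficient : Filler → Carrier
    fillerCoefficient = [ (λ p → - x (Q p)) , (λ b → x (F b)) ]′

    w : Chain 2
    w σ = ∑ fillers (λ i → fillerCoefficient i * δ (fillerPoint i) σ)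

    w-supported : Supported w
    w-supported σ σ∉Δ = ∑-zero fillers (λ i → trans (*-congˡ (δ-supported (fillerPoint i) (Δ-filler i) σ σ∉Δ)) (zeroʳ _))
      where
      Δ-filler : ∀ i → Δ (fillerPoint i)
      Δ-filler (inj₁ p) = Δ-T p
      Δ-filler (inj₂ b) = Δ-U b

    module _ (τ : Assign 2 n) where
      e : Carrier
      e = δ E τ
      π : Fin k → Carrier
      π b = δ (P b) τ
      ΣF ΣP ΣFP ΣPF ΣQ Σ₁ Σ₂ : Carrier
      ΣF  = ∑ (allFin k) (λ b → x (F b))
      ΣP  = ∑ (allFin k) (λ b → x (P b) * π b)
      ΣFP = ∑ (allFin k) (λ b → x (F b) * π b)
      ΣPF = ∑ (allFin k) (λ b → x (F b) * δ (F b) τ)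
      ΣQ  = ∑ (allPair k) (λ p → x (Q p) * δ (Q p) τ)
      Σ₁  = ∑ (allPair k) (λ p → x (Q p) * π (larger p))
      Σ₂  = ∑ (allPair k) (λ p → x (Q p) * π (smaller p))

      x-value : x τ ≈ (x E * e + ΣP) + (ΣPF + ΣQ)
      x-value = trans (expansion₀ x x-supp τ)
        (trans (∑-inj₁-inj₂ (allFin n) _ _) (+-cong (∑-allFin-suc k _) (∑-inj₁-inj₂ (allFin k) (allPair k) _)))

      ∂w-value : ∂ 1 w τ ≈ ((- Σ₁ + ΣQ) + - Σ₂) + ((ΣPF + - (ΣF * e)) + ΣFP)
      ∂w-value = begin
        ∂ 1 w τ
          ≈⟨ ∂-∑δ 1 fillers fillerCoefficient fillerPoint w (λ _ → refl) τ ⟩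
        ∑ fillers (λ i → fillerCoefficient i * incidence 1 (fillerPoint i) τ)
          ≈⟨ ∑-inj₁-inj₂ (allPair k) (allFin k) _ ⟩
        ∑ (allPair k) (λ p → - x (Q p) * incidence 1 (T p) τ) + ∑ (allFin k) (λ b → x (F b) * incidence 1 (U b) τ)
          ≈⟨ +-cong on-T on-U ⟩
        ((- Σ₁ + ΣQ) + - Σ₂) + ((ΣPF + - (ΣF * e)) + ΣFP) ∎
        where
        on-T : ∑ (allPair k) (λ p → - x (Q p) * incidence 1 (T p) τ) ≈ (- Σ₁ + ΣQ) + - Σ₂
        on-T = begin
          ∑ (allPair k) (λ p → - x (Q p) * incidence 1 (T p) τ)
            ≈⟨ ∑-cong (allPair k) (λ p → trans (*-congˡ (incidence-T p τ)) (expand (x (Q p)) _ _ _)) ⟩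
          ∑ (allPair k) (λ p → (- (x (Q p) * π (larger p)) + x (Q p) * δ (Q p) τ) + - (x (Q p) * π (smaller p)))
            ≈⟨ trans (∑-+ (allPair k) _ _) (+-cong (trans (∑-+ (allPair k) _ _) (+-congʳ (∑-neg (allPair k) _))) (∑-neg (allPair k) _)) ⟩
          (- Σ₁ + ΣQ) + - Σ₂ ∎
          where
          expand : ∀ c u v t → - c * ((u - v) + t) ≈ (- (c * u) + c * v) + - (c * t)
          expand c u v t = trans (distribˡ _ _ _)
            (+-cong (trans (distribˡ _ _ _) (+-cong (sym (-‿distribˡ-* c u))
                      (trans (sym (-‿distribˡ-* c (- v))) (trans (-‿cong (sym (-‿distribʳ-* c v))) (-‿involutive _)))))
                    (sym (-‿distribˡ-* c t)))
        on-U : ∑ (allFin k) (λ b → x (F b) * incidence 1 (U b) τ) ≈ (ΣPF + - (ΣF * e)) + ΣFP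
        on-U = begin
          ∑ (allFin k) (λ b → x (F b) * incidence 1 (U b) τ)
            ≈⟨ ∑-cong (allFin k) (λ b → trans (*-congˡ (incidence-U b τ)) (expand (x (F b)) _ _ _)) ⟩
          ∑ (allFin k) (λ b → (x (F b) * δ (F b) τ + - (x (F b) * e)) + x (F b) * π b)
            ≈⟨ trans (∑-+ (allFin k) _ _) (+-congʳ (trans (∑-+ (allFin k) _ _)
                 (+-congˡ (trans (∑-neg (allFin k) _) (-‿cong (∑-*ʳ (allFin k) e (λ b → x (F b)))))))) ⟩
          (ΣPF + - (ΣF * e)) + ΣFP ∎
          where
          expand : ∀ c u v t → c * ((u - v) + t) ≈ (c * u + - (c * v)) + c * t
          expand c u v t = trans (distribˡ _ _ _) (+-congʳ (trans (distribˡ _ _ _) (+-congˡ (sym (-‿distribʳ-* c v)))))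

      lin-value : lin cycle₀ a τ ≈ (x E * e + ΣF * e) + ((ΣP + - ΣFP) + (Σ₁ + Σ₂))
      lin-value = begin
        lin cycle₀ a τ
          ≈⟨ lin-cycle₀ a τ ⟩
        ∑ (allFin n) (λ c → a (≡.subst Fin (≡.sym (nC1≡n n)) c) * δ (basis₀ c) τ)
          ≈⟨ ∑-cong (allFin n) (λ c → reflexive (≡.cong (λ c′ → coefficient c′ * δ (basis₀ c) τ) (subst-subst-sym (nC1≡n n) c))) ⟩
        ∑ (allFin n) (λ c → coefficient c * δ (basis₀ c) τ)
          ≈⟨ ∑-allFin-suc k _ ⟩
        coefficient zero * e + ∑ (allFin k) (λ b → coefficient (suc b) * π b)
          ≈⟨ +-cong (distribʳ _ _ _) (trans (∑-cong (allFin k) (λ b → trans (distribʳ _ _ _) (+-congʳ (trans (distribʳ _ _ _) (+-congˡ (sym (-‿distribˡ-* _ _)))))))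
                (trans (∑-+ (allFin k) _ _) (+-cong (trans (∑-+ (allFin k) _ _) (+-congˡ (∑-neg (allFin k) _))) pairs-value))) ⟩
        (x E * e + ΣF * e) + ((ΣP + - ΣFP) + (Σ₁ + Σ₂)) ∎
        where
        pairs-value : ∑ (allFin k) (λ b → pairsAt b * π b) ≈ Σ₁ + Σ₂
        pairs-value = trans (∑-cong (allFin k) (λ b → distribʳ (π b) _ _))
          (trans (∑-+ (allFin k) _ _)
            (+-cong (∑-fibres (sifting-allFin k) (allPair k) (λ p → x (Q p)) larger π)
                    (∑-fibres (sifting-allFin k) (allPair k) (λ p → x (Q p)) smaller π)))

      x≈∂w+lin : x τ ≈ ∂ 1 w τ + lin cycle₀ a τ
      x≈∂w+lin = trans x-value (sym (begin
        ∂ 1 w τ + lin cycle₀ a τ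
          ≈⟨ +-cong ∂w-value lin-value ⟩
        (((- Σ₁ + ΣQ) + - Σ₂) + ((ΣPF + - (ΣF * e)) + ΣFP)) + ((x E * e + ΣF * e) + ((ΣP + - ΣFP) + (Σ₁ + Σ₂)))
          ≈⟨ regroup (x E * e) ΣP ΣPF ΣQ Σ₁ Σ₂ (ΣF * e) ΣFP (- Σ₁) (- Σ₂) (- (ΣF * e)) (- ΣFP) ⟩
        ((x E * e + ΣP) + (ΣPF + ΣQ)) + ((Σ₁ - Σ₁) + ((Σ₂ - Σ₂) + ((ΣF * e - ΣF * e) + (ΣFP - ΣFP))))
          ≈⟨ +-congˡ (trans (+-cong (-‿inverseʳ Σ₁) (trans (+-cong (-‿inverseʳ Σ₂) (trans (+-cong (-‿inverseʳ _) (-‿inverseʳ ΣFP))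
                        (+-identityʳ 0#))) (+-identityʳ 0#))) (+-identityʳ 0#)) ⟩
        ((x E * e + ΣP) + (ΣPF + ΣQ)) + 0#
          ≈⟨ +-identityʳ _ ⟩
        (x E * e + ΣP) + (ΣPF + ΣQ) ∎))
        where
        -- The negated sums are separate variables: the solver, built without a zero test, can only rearrange.
        regroup : ∀ xe sP sPF sQ s₁ s₂ fe sFP n₁ n₂ nfe nFP →
          (((n₁ + sQ) + n₂) + ((sPF + nfe) + sFP)) + ((xe + fe) + ((sP + nFP) + (s₁ + s₂)))
          ≈ ((xe + sP) + (sPF + sQ)) + ((s₁ + n₁) + ((s₂ + n₂) + ((fe + nfe) + (sFP + nFP))))
        regroup = solve 12 (λ xe sP sPF sQ s₁ s₂ fe sFP n₁ n₂ nfe nFP →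
          ((((n₁ ⊕ sQ) ⊕ n₂) ⊕ ((sPF ⊕ nfe) ⊕ sFP)) ⊕ ((xe ⊕ fe) ⊕ ((sP ⊕ nFP) ⊕ (s₁ ⊕ s₂))))
          ⊜ (((xe ⊕ sP) ⊕ (sPF ⊕ sQ)) ⊕ ((s₁ ⊕ n₁) ⊕ ((s₂ ⊕ n₂) ⊕ ((fe ⊕ nfe) ⊕ (sFP ⊕ nFP)))))) refl
          where open import Tactic.RingSolver.NonReflective almostCommutativeRing

  dimHC₀ : HomologyDim 1 (n C 1)
  dimHC₀ = cycle₀ , (λ i → δ-supported (basis₀ (vertex i)) (Δ-basis₀ (vertex i)) , ∂₀≈0 (cycle₀ i)) , cycles₀-independent ,
    λ x x-supp _ → let open Spanning₀ x x-supp in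
      a , w , w-supported , λ τ → x≈y+z⇒x-z≈y (x≈∂w+lin τ)

  dimHC₋₁ : HomologyDim 0 1
  dimHC₋₁ = one-block-homology Δ-oneBlock

open import Data.Nat using (_≤_; _∸_)
open import Data.Integer using (ℤ; +_; -[1+_]; _+_; ∣_∣; +≤+; -≤-) renaming (_≤_ to _≤ℤ_)

theorem4p8 : ∀ {c ℓ : Level} (F : Field c ℓ) → CharZero F →
    ∀ (n : ℕ) → 5 ≤ n →
    ∀ (r : ℤ) → -[1+ 0 ] ≤ℤ r → r ≤ℤ + 1 →
    dimHC≡ F (completeUniform n (n ∸ 2)) ∣ r + + 1 ∣ (n C ∣ r + + 1 ∣)
theorem4p8 F _ (suc (suc (suc (suc (suc j))))) _ -[1+ 0 ]        _ _ = Homology.dimHC₋₁ F j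
theorem4p8 F _ (suc (suc (suc (suc (suc j))))) _ (+ 0)           _ _ = Homology.dimHC₀ F j
theorem4p8 F _ (suc (suc (suc (suc (suc j))))) _ (+ 1)           _ _ = Homology.dimHC₁ F j
theorem4p8 F _ (suc (suc (suc (suc (suc j))))) _ -[1+ suc m ]    (-≤- ()) _
theorem4p8 F _ (suc (suc (suc (suc (suc j))))) _ (+ suc (suc m)) _ (+≤+ (s≤s ()))
theorem4p8 F _ 0 ()                         _ _ _
theorem4p8 F _ 1 (s≤s ())                   _ _ _
theorem4p8 F _ 2 (s≤s (s≤s ()))             _ _ _
theorem4p8 F _ 3 (s≤s (s≤s (s≤s ())))       _ _ _
theorem4p8 F _ 4 (s≤s (s≤s (s≤s (s≤s ())))) _ _ _
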